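{- Let $A$ be a multi-set of $k$ non-negative integers, let $A^*$ be a sub-multiset of $A$, and let $B$ be a multi-set of $s$ elements sampled uniformly at random from $A$ without replacement. For every $c\ge 1$, $\Pr\left(\left|\sigma(B\cap A^*)-\frac{s}{k}\sigma(A^*)\right|>4c\sqrt{|A^*|}\max(A^*)\right)\le \exp(-c).$
   Context: For a multi-set $Z$, $\sigma(Z)=\sum_{z\in Z}z$, and $\max(\emptyset)=0$. Sampling without replacement means choosing a uniformly random $s$-element subset of the $k$ positions of $A$; $B\cap A^*$ denotes the sampled elements whose positions belong to $A^*$.
   Formalization: The parameter c ranges over the rationals satisfying $c\ge 1$. -}

module Defs where

open import Data.Bool using (Bool; true; false; if_then_else_)
open import Data.Nat as ℕ using (ℕ; zero; suc; _⊔_)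
open import Data.Integer using (+_)
open import Data.Fin using (Fin)
open import Data.Fin.Subset using (Subset; inside; outside; _∩_; ∣_∣)
open import Data.Vec using (Vec; []; _∷_)
open import Data.List using (List; [_]; map; _++_; length; filterᵇ)
open import Data.Rational using (ℚ; 1ℚ; _+_; _*_; _-_; _/_)
open import Data.Rational.Properties using (_<?_)
open import Relation.Nullary using (does)

subsets : (n : ℕ) → List (Subset n)
subsets zero = [ [] ]
subsets (suc n) = map (outside ∷_) (subsets n) ++ map (inside ∷_) (subsets n)

σOn : ∀ {k} → Vec ℕ k → Subset k → ℕ
σOn [] [] = 0
σOn (a ∷ as) (b ∷ bs) = (if b then a else 0) ℕ.+ σOn as bs

-- max of the sub-multiset of A at the positions in S, with max(∅) = 0.
maxOn : ∀ {k} → Vec ℕ k → Subset k → ℕ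
maxOn [] [] = 0
maxOn (a ∷ as) (b ∷ bs) = (if b then a else 0) ⊔ maxOn as bs

ℕtoℚ : ℕ → ℚ
ℕtoℚ n = + n / 1

-- Partial sums Σ_{n=0}^{N} c^n / n! of exp(c).
-- expTerm c n = c^n / n!
expTerm : ℚ → ℕ → ℚ
expTerm c zero = 1ℚ
expTerm c (suc n) = expTerm c n * c * (+ 1 / suc n)

expPartial : ℚ → ℕ → ℚ
expPartial c zero = 1ℚ
expPartial c (suc n) = expPartial c n + expTerm c (suc n)

-- The bad event for a sample B (a set of positions):
--   | σ(B ∩ A*) - (s/k) σ(A*) | > 4 c sqrt(|A*|) max(A*)
-- Both sides are non-negative, so this is equivalent to comparing squares:
--   16 c² |A*| max(A*)² < (σ(B ∩ A*) - (s/k) σ(A*))²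
bad : (k s : ℕ) .{{_ : ℕ.NonZero k}} → Vec ℕ k → Subset k → ℚ → Subset k → Bool
bad k s A Astar c B =
  let D = ℕtoℚ (σOn A (B ∩ Astar)) - (+ s / k) * ℕtoℚ (σOn A Astar)
      M = ℕtoℚ (maxOn A Astar)
      R2 = ℕtoℚ 16 * c * c * ℕtoℚ ∣ Astar ∣ * M * M
  in does (R2 <? D * D)

-- Sample space: all s-element subsets of the k positions (uniform).
samples : (k s : ℕ) → List (Subset k)
samples k s = filterᵇ (λ B → ∣ B ∣ ℕ.≡ᵇ s) (subsets k)

badCount : (k s : ℕ) .{{_ : ℕ.NonZero k}} → Vec ℕ k → Subset k → ℚ → ℕ
badCount k s A Astar c = length (filterᵇ (bad k s A Astar c) (samples k s))

-- A Chernoff bound with a rational base. For θ ≥ 0 the sum of θ ^ (k σ(B ∩ A*)) over the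
-- s-subsets B of positions is the elementary symmetric polynomial e_s of the weights θ ^ (k aᵢ),
-- where aᵢ is Aᵢ on A* and 0 elsewhere; by Maclaurin's inequality it is at most C(k, s) times
-- the s-th power of their mean, so sampling without replacement does no worse than sampling
-- with replacement. Second-order bounds on (1 ± δ) ^ x bound that mean by θ ^ σ(A*) (1 + ε),
-- and Markov's inequality then bounds the proportion of samples with |k σ(B ∩ A*) - s σ(A*)| > X
-- by 2 (1 + ε) ^ s r ^ -X, where r = 1 + δ. Take δ = 1 / (Q k M) with Q = ⌊√|A*|⌋ and
-- M = max(A*). A threshold X ≤ 4 c Q k M exceeded by every bad sample splits into a part whose
-- power of r dominates the partial sums of e ^ c (term by term against the negative binomial
-- series of (1 - 1 / (Q k M + 1)) ^ -n), a part paying for the factor 2 and a part absorbing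
-- (1 + ε) ^ s. If |A*| ≤ 16 or max(A*) = 0 there are no bad samples at all.

module Submission where

open import Defs
open import Data.Nat using (ℕ; NonZero)
open import Data.Fin.Subset using (Subset)
open import Data.Vec using (Vec)
open import Data.List using (length)
open import Data.Rational using (ℚ; 1ℚ; _*_; _≤_)

open import Algebra.Bundles using (CommutativeRing)
open import Data.Bool.Base using (Bool; true; false; if_then_else_)
open import Data.Bool.Properties using (¬-not)
open import Data.Fin.Subset using (inside; outside; _∩_; ∣_∣)
open import Data.Fin.Subset.Properties using (∣p∣≤n)
import Data.Integer.Base as ℤ
import Data.Integer.Tactic.RingSolver as ℤ-Solver
open import Data.List.Base using (List; []; _∷_; _++_; map; filterᵇ)
import Data.List.Properties as List
open import Data.Nat.Base as ℕ using (zero; suc)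
import Data.Nat.Properties as ℕ
import Data.Nat.Tactic.RingSolver as ℕ-Solver
open import Data.Product.Base using (Σ; _×_; _,_; proj₁; proj₂)
open import Data.Rational.Base hiding (NonZero; ∣_∣)
open import Data.Rational.Properties
import Data.Rational.Unnormalised.Base as ℚᵘ
import Data.Rational.Unnormalised.Properties as ℚᵘ
open import Data.Sum.Base using (_⊎_; inj₁; inj₂; [_,_]′)
open import Data.Vec.Base as Vec using (_∷_; []; replicate)
import Data.Vec.Relation.Unary.All as All
open All using (All; _∷_; [])
open import Function.Base using (_∘_)
open import Level using (0ℓ)
open import Relation.Binary.PropositionalEquality
open import Relation.Nullary.Decidable using (Dec; yes; no; proof; dec⇒maybe; T?)
open import Relation.Nullary.Negation using (contradiction)
open import Relation.Nullary.Reflects using (Reflects; invert)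
open import Tactic.RingSolver using (solve-∀)
open import Tactic.RingSolver.Core.AlmostCommutativeRing
  using (AlmostCommutativeRing; fromCommutativeRing)

open import Algebra.Properties.CommutativeSemiring.Exp
  (CommutativeRing.commutativeSemiring +-*-commutativeRing)
  using (_^_; ^-homo-*; ^-assocʳ; ^-distrib-*)

ℚ-ring : AlmostCommutativeRing 0ℓ 0ℓ
ℚ-ring = fromCommutativeRing +-*-commutativeRing (dec⇒maybe ∘ (0ℚ ≟_))

private
  variable
    p q r w : ℚ
    m n : ℕ

*-nonNeg : 0ℚ ≤ p → 0ℚ ≤ q → 0ℚ ≤ p * q
*-nonNeg {p} {q} 0≤p 0≤q =
  nonNegative⁻¹ _ {{nonNeg*nonNeg⇒nonNeg p {{nonNegative 0≤p}} q {{nonNegative 0≤q}}}}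

*-pos : 0ℚ < p → 0ℚ < q → 0ℚ < p * q
*-pos {p} {q} 0<p 0<q = positive⁻¹ _ {{pos*pos⇒pos p {{positive 0<p}} q {{positive 0<q}}}}

+-nonNeg : 0ℚ ≤ p → 0ℚ ≤ q → 0ℚ ≤ p + q
+-nonNeg = +-mono-≤

square-nonNeg : ∀ p → 0ℚ ≤ p * p
square-nonNeg p with ≤-total 0ℚ p
... | inj₁ 0≤p = *-nonNeg 0≤p 0≤p
... | inj₂ p≤0 = subst (0ℚ ≤_) (neg*neg p) (*-nonNeg (neg-antimono-≤ p≤0) (neg-antimono-≤ p≤0))
  where
  neg*neg : ∀ p → - p * - p ≡ p * p
  neg*neg = solve-∀ ℚ-ring

*-monoʳ-≤ : 0ℚ ≤ r → p ≤ q → p * r ≤ q * r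
*-monoʳ-≤ {r} 0≤r = *-monoʳ-≤-nonNeg r {{nonNegative 0≤r}}

*-monoˡ-≤ : 0ℚ ≤ r → p ≤ q → r * p ≤ r * q
*-monoˡ-≤ {r} 0≤r = *-monoˡ-≤-nonNeg r {{nonNegative 0≤r}}

*-mono-≤ : ∀ {p₁ p₂ q₁ q₂} → 0ℚ ≤ p₂ → 0ℚ ≤ q₁ → p₁ ≤ p₂ → q₁ ≤ q₂ → p₁ * q₁ ≤ p₂ * q₂
*-mono-≤ 0≤p₂ 0≤q₁ p₁≤p₂ q₁≤q₂ = ≤-trans (*-monoʳ-≤ 0≤q₁ p₁≤p₂) (*-monoˡ-≤ 0≤p₂ q₁≤q₂)

*-cancelʳ-≤ : 0ℚ < r → p * r ≤ q * r → p ≤ q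
*-cancelʳ-≤ {r} 0<r = *-cancelʳ-≤-pos r {{positive 0<r}}

*-cancelˡ-≤ : 0ℚ < r → r * p ≤ r * q → p ≤ q
*-cancelˡ-≤ {r} 0<r = *-cancelˡ-≤-pos r {{positive 0<r}}

≤-by-gap : 0ℚ ≤ r → q ≡ p + r → p ≤ q
≤-by-gap {r} {q} {p} 0≤r refl = subst (_≤ p + r) (+-identityʳ p) (+-monoʳ-≤ p 0≤r)

p≤q⇒0≤q-p : p ≤ q → 0ℚ ≤ q - p
p≤q⇒0≤q-p {p} {q} p≤q = subst (_≤ q - p) (+-inverseʳ p) (+-monoˡ-≤ (- p) p≤q)

0<1 : 0ℚ < 1ℚ
0<1 = positive⁻¹ 1ℚ

0≤1 : 0ℚ ≤ 1ℚ
0≤1 = <⇒≤ 0<1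

<-square⇒ : 0ℚ ≤ p → p * p < q * q → p < q ⊎ p < - q
<-square⇒ {p} {q} 0≤p p²<q² with p <? q | p <? - q
... | yes p<q | _        = inj₁ p<q
... | no  _   | yes p<-q = inj₂ p<-q
... | no  p≮q | no  p≮-q = contradiction (<-≤-trans p²<q² q²≤p²) (<-irrefl refl)
  where
  q²≤p² : q * q ≤ p * p
  q²≤p² with ≤-total 0ℚ q
  ... | inj₁ 0≤q = *-mono-≤ 0≤p 0≤q (≮⇒≥ p≮q) (≮⇒≥ p≮q)
  ... | inj₂ q≤0 = subst (_≤ p * p) (neg*neg q) (*-mono-≤ 0≤p (neg-antimono-≤ q≤0) (≮⇒≥ p≮-q) (≮⇒≥ p≮-q))
    where
    neg*neg : ∀ q → - q * - q ≡ q * q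
    neg*neg = solve-∀ ℚ-ring

⅓ ⅔ ¼ ¾ : ℚ
⅓ = ℤ.+ 1 / 3
⅔ = ℤ.+ 2 / 3
¼ = ℤ.+ 1 / 4
¾ = ℤ.+ 3 / 4

ι : ℕ → ℚ
ι = ℕtoℚ

ι-toℚᵘ : ∀ n → toℚᵘ (ι n) ℚᵘ.≃ ℚᵘ.mkℚᵘ (ℤ.+ n) 0
ι-toℚᵘ n = toℚᵘ-fromℚᵘ (ℚᵘ.mkℚᵘ (ℤ.+ n) 0)

ι-suc : ∀ n → ι (suc n) ≡ 1ℚ + ι n
ι-suc n = toℚᵘ-injective (begin-equality
  toℚᵘ (ι (suc n))                               ≃⟨ ι-toℚᵘ (suc n) ⟩
  ℚᵘ.mkℚᵘ (ℤ.+ suc n) 0                          ≃⟨ ℚᵘ.*≡* (1+i≡ (ℤ.+ n)) ⟩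
  toℚᵘ 1ℚ ℚᵘ.+ ℚᵘ.mkℚᵘ (ℤ.+ n) 0                ≃⟨ ℚᵘ.+-congʳ (toℚᵘ 1ℚ) (ι-toℚᵘ n) ⟨
  toℚᵘ 1ℚ ℚᵘ.+ toℚᵘ (ι n)                       ≃⟨ toℚᵘ-homo-+ 1ℚ (ι n) ⟨
  toℚᵘ (1ℚ + ι n)                                ∎)
  where
  open ℚᵘ.≤-Reasoning
  1+i≡ : ∀ i → (ℤ.+ 1 ℤ.+ i) ℤ.* ℤ.+ 1 ≡ (ℤ.+ 1 ℤ.* ℤ.+ 1 ℤ.+ i ℤ.* ℤ.+ 1) ℤ.* ℤ.+ 1
  1+i≡ = ℤ-Solver.solve-∀

ι-+ : ∀ m n → ι (m ℕ.+ n) ≡ ι m + ι n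
ι-+ zero    n = sym (+-identityˡ (ι n))
ι-+ (suc m) n = begin
  ι (suc (m ℕ.+ n))   ≡⟨ ι-suc (m ℕ.+ n) ⟩
  1ℚ + ι (m ℕ.+ n)    ≡⟨ cong (1ℚ +_) (ι-+ m n) ⟩
  1ℚ + (ι m + ι n)    ≡⟨ +-assoc 1ℚ (ι m) (ι n) ⟨
  1ℚ + ι m + ι n      ≡⟨ cong (_+ ι n) (ι-suc m) ⟨
  ι (suc m) + ι n     ∎
  where open ≡-Reasoning

ι-* : ∀ m n → ι (m ℕ.* n) ≡ ι m * ι n
ι-* zero    n = sym (*-zeroˡ (ι n))
ι-* (suc m) n = begin
  ι (n ℕ.+ m ℕ.* n)     ≡⟨ ι-+ n (m ℕ.* n) ⟩
  ι n + ι (m ℕ.* n)     ≡⟨ cong (ι n +_) (ι-* m n) ⟩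
  ι n + ι m * ι n       ≡⟨ cong (_+ ι m * ι n) (*-identityˡ (ι n)) ⟨
  1ℚ * ι n + ι m * ι n  ≡⟨ *-distribʳ-+ (ι n) 1ℚ (ι m) ⟨
  (1ℚ + ι m) * ι n      ≡⟨ cong (_* ι n) (ι-suc m) ⟨
  ι (suc m) * ι n       ∎
  where open ≡-Reasoning

ι-nonNeg : ∀ n → 0ℚ ≤ ι n
ι-nonNeg n = nonNegative⁻¹ _ {{normalize-nonNeg n 1}}

ι-pos : ∀ n .{{_ : NonZero n}} → 0ℚ < ι n
ι-pos (suc n) = subst (0ℚ <_) (sym (ι-suc n))
  (subst (_< 1ℚ + ι n) (+-identityʳ 0ℚ) (+-mono-<-≤ 0<1 (ι-nonNeg n)))

ι-mono-≤ : m ℕ.≤ n → ι m ≤ ι n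
ι-mono-≤ {m} {n} m≤n = ≤-by-gap (ι-nonNeg (n ℕ.∸ m))
  (trans (cong ι (sym (ℕ.m+[n∸m]≡n m≤n))) (ι-+ m (n ℕ.∸ m)))

ι-cancel-< : ι m < ι n → m ℕ.< n
ι-cancel-< {m} {n} ιm<ιn with m ℕ.<? n
... | yes m<n = m<n
... | no  m≮n = contradiction (≤-<-trans (ι-mono-≤ (ℕ.≮⇒≥ m≮n)) ιm<ιn) (<-irrefl refl)

square-<⇒apart : ∀ x a b → ι x * ι x < (ι a - ι b) * (ι a - ι b) → b ℕ.+ x ℕ.< a ⊎ a ℕ.+ x ℕ.< b
square-<⇒apart x a b x²<[a-b]² with <-square⇒ (ι-nonNeg x) x²<[a-b]²
... | inj₁ x<a-b  = inj₁ (ι-cancel-< (subst₂ _<_ (sym (ι-+ b x)) (b+[a-b] (ι a) (ι b)) (+-monoʳ-< (ι b) x<a-b)))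
  where
  b+[a-b] : ∀ a b → b + (a - b) ≡ a
  b+[a-b] = solve-∀ ℚ-ring
... | inj₂ x<b-a = inj₂ (ι-cancel-< (subst₂ _<_ (sym (ι-+ a x)) (a-[a-b] (ι a) (ι b)) (+-monoʳ-< (ι a) x<b-a)))
  where
  a-[a-b] : ∀ a b → a + - (a - b) ≡ b
  a-[a-b] = solve-∀ ℚ-ring

inv : (n : ℕ) → .{{NonZero n}} → ℚ
inv n = ℤ.+ 1 / n

ι*inv : ∀ n .{{_ : NonZero n}} → ι n * inv n ≡ 1ℚ
ι*inv (suc n) = toℚᵘ-injective (begin-equality
  toℚᵘ (ι (suc n) * inv (suc n))
    ≃⟨ toℚᵘ-homo-* (ι (suc n)) (inv (suc n)) ⟩
  toℚᵘ (ι (suc n)) ℚᵘ.* toℚᵘ (inv (suc n))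
    ≃⟨ ℚᵘ.*-cong (ι-toℚᵘ (suc n)) (toℚᵘ-fromℚᵘ (ℚᵘ.mkℚᵘ (ℤ.+ 1) n)) ⟩
  ℚᵘ.mkℚᵘ (ℤ.+ suc n) 0 ℚᵘ.* ℚᵘ.mkℚᵘ (ℤ.+ 1) n
    ≃⟨ ℚᵘ.*≡* (i*1*1≡1*[1*i] (ℤ.+ suc n)) ⟩
  toℚᵘ 1ℚ ∎)
  where
  open ℚᵘ.≤-Reasoning
  i*1*1≡1*[1*i] : ∀ i → i ℤ.* ℤ.+ 1 ℤ.* ℤ.+ 1 ≡ ℤ.+ 1 ℤ.* (ℤ.+ 1 ℤ.* i)
  i*1*1≡1*[1*i] = ℤ-Solver.solve-∀

inv-nonNeg : ∀ n .{{_ : NonZero n}} → 0ℚ ≤ inv n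
inv-nonNeg n = nonNegative⁻¹ _ {{normalize-nonNeg 1 n}}

/-*-cancel : ∀ s k .{{_ : NonZero k}} → (ℤ.+ s / k) * ι k ≡ ι s
/-*-cancel s (suc k) = toℚᵘ-injective (begin-equality
  toℚᵘ ((ℤ.+ s / suc k) * ι (suc k))
    ≃⟨ toℚᵘ-homo-* (ℤ.+ s / suc k) (ι (suc k)) ⟩
  toℚᵘ (ℤ.+ s / suc k) ℚᵘ.* toℚᵘ (ι (suc k))
    ≃⟨ ℚᵘ.*-cong (toℚᵘ-fromℚᵘ (ℚᵘ.mkℚᵘ (ℤ.+ s) k)) (ι-toℚᵘ (suc k)) ⟩
  ℚᵘ.mkℚᵘ (ℤ.+ s) k ℚᵘ.* ℚᵘ.mkℚᵘ (ℤ.+ suc k) 0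
    ≃⟨ ℚᵘ.*≡* (reassoc (ℤ.+ s) (ℤ.+ suc k)) ⟩
  ℚᵘ.mkℚᵘ (ℤ.+ s) 0
    ≃⟨ ι-toℚᵘ s ⟨
  toℚᵘ (ι s) ∎)
  where
  open ℚᵘ.≤-Reasoning
  reassoc : ∀ a b → a ℤ.* b ℤ.* ℤ.+ 1 ≡ a ℤ.* (b ℤ.* ℤ.+ 1)
  reassoc = ℤ-Solver.solve-∀

archimedes : ∀ x → Σ ℕ λ n → x ≤ ι n
archimedes x@(mkℚ (ℤ.+ n) d _) = n , (begin
  x                                ≡⟨ *-identityʳ x ⟨
  x * 1ℚ                           ≤⟨ *-monoˡ-≤ (nonNegative⁻¹ x) (ι-mono-≤ (ℕ.s≤s (ℕ.z≤n {d}))) ⟩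
  x * ι (suc d)                    ≡⟨ cong (_* ι (suc d)) (↥p/↧p≡p x) ⟨
  (ℤ.+ n / suc d) * ι (suc d)      ≡⟨ /-*-cancel n (suc d) ⟩
  ι n                              ∎)
  where open ≤-Reasoning
archimedes x@(mkℚ ℤ.-[1+ _ ] _ _) = 0 , <⇒≤ (negative⁻¹ x)

nat-ceiling : ∀ x → 0ℚ ≤ x → Σ ℕ λ b → x ≤ ι b × ι b < x + 1ℚ
nat-ceiling x 0≤x = descend (proj₁ (archimedes x)) (proj₂ (archimedes x))
  where
  descend : ∀ n → x ≤ ι n → Σ ℕ λ b → x ≤ ι b × ι b < x + 1ℚ
  descend zero    x≤0   = 0 , x≤0 , +-mono-≤-< 0≤x 0<1
  descend (suc n) x≤n+1 with x ≤? ι n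
  ... | yes x≤n = descend n x≤n
  ... | no  x≰n = suc n , x≤n+1 ,
        subst₂ _<_ (sym (ι-suc n)) (+-comm 1ℚ x) (+-monoʳ-< 1ℚ (≰⇒> x≰n))

isqrt : ∀ m → Σ ℕ λ Q → Q ℕ.* Q ℕ.≤ m × m ℕ.< suc Q ℕ.* suc Q
isqrt zero    = 0 , ℕ.z≤n , ℕ.s≤s ℕ.z≤n
isqrt (suc m) with isqrt m
... | Q , Q²≤m , m<[Q+1]² with suc Q ℕ.* suc Q ℕ.≤? suc m
...   | yes [Q+1]²≤m+1 = suc Q , [Q+1]²≤m+1 ,
          ℕ.≤-<-trans m<[Q+1]² (ℕ.*-mono-< (ℕ.n<1+n (suc Q)) (ℕ.n<1+n (suc Q)))
...   | no  [Q+1]²≰m+1 = Q , ℕ.≤-trans Q²≤m (ℕ.n≤1+n m) , ℕ.≰⇒> [Q+1]²≰m+1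

16<[1+Q]²⇒4≤Q : ∀ {Q} → 16 ℕ.< suc Q ℕ.* suc Q → 4 ℕ.≤ Q
16<[1+Q]²⇒4≤Q {Q} 16<[Q+1]² with 4 ℕ.≤? Q
... | yes 4≤Q = 4≤Q
... | no  4≰Q = contradiction 16<[Q+1]² (ℕ.≤⇒≯ (ℕ.*-mono-≤ (ℕ.≰⇒> 4≰Q) (ℕ.≰⇒> 4≰Q)))

2m≤3Q² : ∀ {m Q} → 4 ℕ.≤ Q → m ℕ.< suc Q ℕ.* suc Q → 2 ℕ.* m ℕ.≤ 3 ℕ.* (Q ℕ.* Q)
2m≤3Q² {m} {Q} 4≤Q m<[Q+1]² = begin
  2 ℕ.* m                          ≤⟨ ℕ.*-monoʳ-≤ 2 m≤Q²+2Q ⟩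
  2 ℕ.* (Q ℕ.* Q ℕ.+ 2 ℕ.* Q)      ≡⟨ expand Q ⟩
  2 ℕ.* (Q ℕ.* Q) ℕ.+ 4 ℕ.* Q      ≤⟨ ℕ.+-monoʳ-≤ (2 ℕ.* (Q ℕ.* Q)) (ℕ.*-monoˡ-≤ Q 4≤Q) ⟩
  2 ℕ.* (Q ℕ.* Q) ℕ.+ Q ℕ.* Q      ≡⟨ collect Q ⟩
  3 ℕ.* (Q ℕ.* Q)                  ∎
  where
  open ℕ.≤-Reasoning
  square-suc : ∀ Q → suc Q ℕ.* suc Q ≡ suc (Q ℕ.* Q ℕ.+ 2 ℕ.* Q)
  square-suc = ℕ-Solver.solve-∀
  m≤Q²+2Q : m ℕ.≤ Q ℕ.* Q ℕ.+ 2 ℕ.* Q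
  m≤Q²+2Q = ℕ.s≤s⁻¹ (subst (m ℕ.<_) (square-suc Q) m<[Q+1]²)
  expand : ∀ Q → 2 ℕ.* (Q ℕ.* Q ℕ.+ 2 ℕ.* Q) ≡ 2 ℕ.* (Q ℕ.* Q) ℕ.+ 4 ℕ.* Q
  expand = ℕ-Solver.solve-∀
  collect : ∀ Q → 2 ℕ.* (Q ℕ.* Q) ℕ.+ Q ℕ.* Q ≡ 3 ℕ.* (Q ℕ.* Q)
  collect = ℕ-Solver.solve-∀

1^n≡1 : ∀ n → 1ℚ ^ n ≡ 1ℚ
1^n≡1 zero    = refl
1^n≡1 (suc n) = trans (*-identityˡ (1ℚ ^ n)) (1^n≡1 n)

^-nonNeg : ∀ n → 0ℚ ≤ p → 0ℚ ≤ p ^ n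
^-nonNeg zero    _   = 0≤1
^-nonNeg (suc n) 0≤p = *-nonNeg 0≤p (^-nonNeg n 0≤p)

^-pos : ∀ n → 0ℚ < p → 0ℚ < p ^ n
^-pos zero    _   = 0<1
^-pos (suc n) 0<p = *-pos 0<p (^-pos n 0<p)

^-monoˡ-≤ : ∀ n → 0ℚ ≤ p → p ≤ q → p ^ n ≤ q ^ n
^-monoˡ-≤ zero    _   _   = ≤-refl
^-monoˡ-≤ (suc n) 0≤p p≤q = *-mono-≤ (≤-trans 0≤p p≤q) (^-nonNeg n 0≤p) p≤q (^-monoˡ-≤ n 0≤p p≤q)

^-monoʳ-≤ : 1ℚ ≤ p → m ℕ.≤ n → p ^ m ≤ p ^ n
^-monoʳ-≤ {p} {m} {n} 1≤p m≤n = begin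
  p ^ m                   ≡⟨ *-identityʳ (p ^ m) ⟨
  p ^ m * 1ℚ              ≤⟨ *-monoˡ-≤ (^-nonNeg m 0≤p) (1≤p^ (n ℕ.∸ m)) ⟩
  p ^ m * p ^ (n ℕ.∸ m)   ≡⟨ ^-homo-* p m (n ℕ.∸ m) ⟨
  p ^ (m ℕ.+ (n ℕ.∸ m))   ≡⟨ cong (p ^_) (ℕ.m+[n∸m]≡n m≤n) ⟩
  p ^ n                   ∎
  where
  open ≤-Reasoning
  0≤p = ≤-trans 0≤1 1≤p
  1≤p^ : ∀ k → 1ℚ ≤ p ^ k
  1≤p^ zero    = ≤-refl
  1≤p^ (suc k) = *-mono-≤ 0≤p 0≤1 1≤p (1≤p^ k)

^-≤-quotient : ∀ {θ θ′} {a b X} → θ′ * θ ≡ 1ℚ → 1ℚ ≤ θ → 0ℚ ≤ θ′ → a ℕ.+ X ℕ.≤ b → θ ^ X ≤ θ′ ^ a * θ ^ b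
^-≤-quotient {θ} {θ′} {a} {b} {X} θ′θ≡1 1≤θ 0≤θ′ a+X≤b = begin
  θ ^ X                         ≡⟨ *-identityˡ (θ ^ X) ⟨
  1ℚ * θ ^ X                    ≡⟨ cong (_* θ ^ X) (trans (sym (1^n≡1 a)) (cong (_^ a) (sym θ′θ≡1))) ⟩
  (θ′ * θ) ^ a * θ ^ X          ≡⟨ cong (_* θ ^ X) (^-distrib-* θ′ θ a) ⟩
  θ′ ^ a * θ ^ a * θ ^ X        ≡⟨ *-assoc (θ′ ^ a) (θ ^ a) (θ ^ X) ⟩
  θ′ ^ a * (θ ^ a * θ ^ X)      ≡⟨ cong (θ′ ^ a *_) (^-homo-* θ a X) ⟨
  θ′ ^ a * θ ^ (a ℕ.+ X)        ≤⟨ *-monoˡ-≤ (^-nonNeg a 0≤θ′) (^-monoʳ-≤ 1≤θ a+X≤b) ⟩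
  θ′ ^ a * θ ^ b                ∎
  where open ≤-Reasoning

bernoulli-homogeneous : ∀ n → 0ℚ ≤ p → 0ℚ ≤ p + q → p ^ n * (p + ι (suc n) * q) ≤ (p + q) ^ suc n
bernoulli-homogeneous {p} {q} zero _ _ = ≤-reflexive (base p q)
  where
  base : ∀ p q → 1ℚ * (p + ι 1 * q) ≡ (p + q) * 1ℚ
  base = solve-∀ ℚ-ring
bernoulli-homogeneous {p} {q} (suc n) 0≤p 0≤p+q = begin
  p ^ suc n * (p + ι (suc (suc n)) * q)   ≤⟨ ≤-by-gap gap-nonNeg step ⟩
  (p + q) * (p ^ n * (p + ι (suc n) * q)) ≤⟨ *-monoˡ-≤ 0≤p+q (bernoulli-homogeneous n 0≤p 0≤p+q) ⟩
  (p + q) * (p + q) ^ suc n               ∎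
  where
  open ≤-Reasoning
  gap-nonNeg = *-nonNeg (*-nonNeg (ι-nonNeg (suc n)) (square-nonNeg q)) (^-nonNeg n 0≤p)
  expand : ∀ p q P N → (p + q) * (P * (p + N * q)) ≡ p * P * (p + (1ℚ + N) * q) + N * (q * q) * P
  expand = solve-∀ ℚ-ring
  step : (p + q) * (p ^ n * (p + ι (suc n) * q))
         ≡ p ^ suc n * (p + ι (suc (suc n)) * q) + ι (suc n) * (q * q) * p ^ n
  step = trans (expand p q (p ^ n) (ι (suc n)))
    (cong (λ N → p ^ suc n * (p + N * q) + ι (suc n) * (q * q) * p ^ n) (sym (ι-suc (suc n))))

bernoulli : ∀ n → 0ℚ ≤ 1ℚ + q → 1ℚ + ι n * q ≤ (1ℚ + q) ^ n
bernoulli {q} zero    _      = ≤-reflexive (base q)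
  where
  base : ∀ q → 1ℚ + ι 0 * q ≡ 1ℚ
  base = solve-∀ ℚ-ring
bernoulli {q} (suc n) 0≤1+q = subst (_≤ (1ℚ + q) ^ suc n)
  (trans (cong (_* (1ℚ + ι (suc n) * q)) (1^n≡1 n)) (*-identityˡ _))
  (bernoulli-homogeneous n 0≤1 0≤1+q)

taylor⁺ : ∀ x → 0ℚ ≤ p → ι x * p ≤ ½ →
  (1ℚ + p) ^ x ≤ 1ℚ + ι x * p + ⅔ * (ι x * p) * (ι x * p)
taylor⁺ {p} zero _ _ = ≤-reflexive (base p)
  where
  base : ∀ p → 1ℚ ≡ 1ℚ + ι 0 * p + ⅔ * (ι 0 * p) * (ι 0 * p)
  base = solve-∀ ℚ-ring
taylor⁺ {p} (suc x) 0≤p [x+1]p≤½ = begin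
  (1ℚ + p) * (1ℚ + p) ^ x                  ≤⟨ *-monoˡ-≤ (+-nonNeg 0≤1 0≤p) (taylor⁺ x 0≤p xp≤½) ⟩
  (1ℚ + p) * (1ℚ + X * p + ⅔ * (X * p) * (X * p))
    ≤⟨ ≤-by-gap gap-nonNeg (step X p) ⟩
  1ℚ + (1ℚ + X) * p + ⅔ * ((1ℚ + X) * p) * ((1ℚ + X) * p)
    ≡⟨ cong (λ Y → 1ℚ + Y * p + ⅔ * (Y * p) * (Y * p)) (ι-suc x) ⟨
  1ℚ + ι (suc x) * p + ⅔ * (ι (suc x) * p) * (ι (suc x) * p) ∎
  where
  open ≤-Reasoning
  X = ι x
  xp≤½ : X * p ≤ ½
  xp≤½ = ≤-trans (*-monoʳ-≤ 0≤p (ι-mono-≤ (ℕ.n≤1+n x))) [x+1]p≤½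
  2Xp≤1 : (1ℚ + 1ℚ) * (X * p) ≤ 1ℚ
  2Xp≤1 = *-monoˡ-≤ (nonNegative⁻¹ (1ℚ + 1ℚ)) xp≤½
  gap-nonNeg : 0ℚ ≤ p * p * (X * ⅓ * (1ℚ - (1ℚ + 1ℚ) * (X * p)) + ⅔)
  gap-nonNeg = *-nonNeg (square-nonNeg p)
    (+-nonNeg (*-nonNeg (*-nonNeg (ι-nonNeg x) (nonNegative⁻¹ ⅓)) (p≤q⇒0≤q-p 2Xp≤1)) (nonNegative⁻¹ ⅔))
  step : ∀ X p → 1ℚ + (1ℚ + X) * p + ⅔ * ((1ℚ + X) * p) * ((1ℚ + X) * p)
               ≡ (1ℚ + p) * (1ℚ + X * p + ⅔ * (X * p) * (X * p))
                 + p * p * (X * ⅓ * (1ℚ - (1ℚ + 1ℚ) * (X * p)) + ⅔)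
  step = solve-∀ ℚ-ring

taylor⁻ : ∀ x → 0ℚ ≤ p → p ≤ 1ℚ →
  (1ℚ - p) ^ x ≤ 1ℚ - ι x * p + ½ * (ι x * p) * (ι x * p)
taylor⁻ {p} zero _ _ = ≤-reflexive (base p)
  where
  base : ∀ p → 1ℚ ≡ 1ℚ - ι 0 * p + ½ * (ι 0 * p) * (ι 0 * p)
  base = solve-∀ ℚ-ring
taylor⁻ {p} (suc x) 0≤p p≤1 = begin
  (1ℚ - p) * (1ℚ - p) ^ x                  ≤⟨ *-monoˡ-≤ (p≤q⇒0≤q-p p≤1) (taylor⁻ x 0≤p p≤1) ⟩
  (1ℚ - p) * (1ℚ - X * p + ½ * (X * p) * (X * p))
    ≤⟨ ≤-by-gap gap-nonNeg (step X p) ⟩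
  1ℚ - (1ℚ + X) * p + ½ * ((1ℚ + X) * p) * ((1ℚ + X) * p)
    ≡⟨ cong (λ Y → 1ℚ - Y * p + ½ * (Y * p) * (Y * p)) (ι-suc x) ⟨
  1ℚ - ι (suc x) * p + ½ * (ι (suc x) * p) * (ι (suc x) * p) ∎
  where
  open ≤-Reasoning
  X = ι x
  gap-nonNeg : 0ℚ ≤ p * p * (½ + ½ * X * X * p)
  gap-nonNeg = *-nonNeg (square-nonNeg p) (+-nonNeg (nonNegative⁻¹ ½)
    (*-nonNeg (*-nonNeg (*-nonNeg (nonNegative⁻¹ ½) (ι-nonNeg x)) (ι-nonNeg x)) 0≤p))
  step : ∀ X p → 1ℚ - (1ℚ + X) * p + ½ * ((1ℚ + X) * p) * ((1ℚ + X) * p)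
               ≡ (1ℚ - p) * (1ℚ - X * p + ½ * (X * p) * (X * p)) + p * p * (½ + ½ * X * X * p)
  step = solve-∀ ℚ-ring

quadratic≤affine : ∀ {κ y b M} → 0ℚ ≤ κ → b ℕ.≤ M →
  1ℚ + ι b * y + κ * (ι b * y) * (ι b * y) ≤ 1ℚ + (y + κ * y * y * ι M) * ι b
quadratic≤affine {κ} {y} {b} {M} 0≤κ b≤M = ≤-by-gap
  (*-nonNeg (*-nonNeg (*-nonNeg 0≤κ (square-nonNeg y)) (ι-nonNeg b)) (p≤q⇒0≤q-p (ι-mono-≤ b≤M)))
  (expand κ y (ι b) (ι M))
  where
  expand : ∀ κ y b M → 1ℚ + (y + κ * y * y * M) * b
         ≡ 1ℚ + b * y + κ * (b * y) * (b * y) + κ * (y * y) * b * (M - b)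
  expand = solve-∀ ℚ-ring

taylor⁺-affine : ∀ {p K M} → 0ℚ ≤ p → ι K * ι M * p ≤ ½ → ∀ {b} → b ℕ.≤ M →
  (1ℚ + p) ^ (K ℕ.* b) ≤ 1ℚ + (ι K * p + ⅔ * (ι K * p) * (ι K * p) * ι M) * ι b
taylor⁺-affine {p} {K} {M} 0≤p KMp≤½ {b} b≤M = begin
  (1ℚ + p) ^ (K ℕ.* b)
    ≤⟨ taylor⁺ (K ℕ.* b) 0≤p (≤-trans (≤-reflexive (cong (_* p) (ι-* K b))) Kbp≤½) ⟩
  1ℚ + ι (K ℕ.* b) * p + ⅔ * (ι (K ℕ.* b) * p) * (ι (K ℕ.* b) * p)
    ≡⟨ cong (λ x → 1ℚ + x * p + ⅔ * (x * p) * (x * p)) (ι-* K b) ⟩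
  1ℚ + ι K * ι b * p + ⅔ * (ι K * ι b * p) * (ι K * ι b * p)
    ≡⟨ reorder (ι K) (ι b) p ⟩
  1ℚ + ι b * (ι K * p) + ⅔ * (ι b * (ι K * p)) * (ι b * (ι K * p))
    ≤⟨ quadratic≤affine (nonNegative⁻¹ ⅔) b≤M ⟩
  1ℚ + (ι K * p + ⅔ * (ι K * p) * (ι K * p) * ι M) * ι b ∎
  where
  open ≤-Reasoning
  Kbp≤½ : ι K * ι b * p ≤ ½
  Kbp≤½ = ≤-trans (*-monoʳ-≤ 0≤p (*-monoˡ-≤ (ι-nonNeg K) (ι-mono-≤ b≤M))) KMp≤½
  reorder : ∀ K b p → 1ℚ + K * b * p + ⅔ * (K * b * p) * (K * b * p)
          ≡ 1ℚ + b * (K * p) + ⅔ * (b * (K * p)) * (b * (K * p))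
  reorder = solve-∀ ℚ-ring

taylor⁻-affine : ∀ {p K M} → 0ℚ ≤ p → p ≤ 1ℚ → ∀ {b} → b ℕ.≤ M →
  (1ℚ - p) ^ (K ℕ.* b) ≤ 1ℚ + (- (ι K * p) + ½ * - (ι K * p) * - (ι K * p) * ι M) * ι b
taylor⁻-affine {p} {K} {M} 0≤p p≤1 {b} b≤M = begin
  (1ℚ - p) ^ (K ℕ.* b)
    ≤⟨ taylor⁻ (K ℕ.* b) 0≤p p≤1 ⟩
  1ℚ - ι (K ℕ.* b) * p + ½ * (ι (K ℕ.* b) * p) * (ι (K ℕ.* b) * p)
    ≡⟨ cong (λ x → 1ℚ - x * p + ½ * (x * p) * (x * p)) (ι-* K b) ⟩
  1ℚ - ι K * ι b * p + ½ * (ι K * ι b * p) * (ι K * ι b * p)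
    ≡⟨ reorder (ι K) (ι b) p ⟩
  1ℚ + ι b * - (ι K * p) + ½ * (ι b * - (ι K * p)) * (ι b * - (ι K * p))
    ≤⟨ quadratic≤affine (nonNegative⁻¹ ½) b≤M ⟩
  1ℚ + (- (ι K * p) + ½ * - (ι K * p) * - (ι K * p) * ι M) * ι b ∎
  where
  open ≤-Reasoning
  reorder : ∀ K b p → 1ℚ - K * b * p + ½ * (K * b * p) * (K * b * p)
          ≡ 1ℚ + b * - (K * p) + ½ * (b * - (K * p)) * (b * - (K * p))
  reorder = solve-∀ ℚ-ring

-- Partial sums of the exponential series

module NegativeBinomial (x : ℚ) where

  -- term n j = C(n + j - 1, j) x ^ j, the coefficient of the series of (1 - x) ^ -n.
  term : ℕ → ℕ → ℚ
  term n zero    = 1ℚ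
  term n (suc j) = term n j * x * ι (n ℕ.+ j) * inv (suc j)

  partialSum : ℕ → ℕ → ℚ
  partialSum n zero    = 1ℚ
  partialSum n (suc N) = partialSum n N + term n (suc N)

  term-shift : ∀ n j → term n (suc j) ≡ term (suc n) j * x * ι n * inv (suc j)
  term-shift n zero    = cong (λ k → 1ℚ * x * ι k * inv 1) (ℕ.+-identityʳ n)
  term-shift n (suc j) = begin
    term n (suc j) * x * ι (n ℕ.+ suc j) * inv (suc (suc j))
      ≡⟨ cong₂ (λ t k → t * x * ι k * inv (suc (suc j))) (term-shift n j) (ℕ.+-suc n j) ⟩
    term (suc n) j * x * ι n * inv (suc j) * x * ι (suc n ℕ.+ j) * inv (suc (suc j))
      ≡⟨ swap (term (suc n) j) x (ι n) (inv (suc j)) (ι (suc n ℕ.+ j)) (inv (suc (suc j))) ⟩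
    term (suc n) j * x * ι (suc n ℕ.+ j) * inv (suc j) * x * ι n * inv (suc (suc j)) ∎
    where
    open ≡-Reasoning
    swap : ∀ t x a b c d → t * x * a * b * x * c * d ≡ t * x * c * b * x * a * d
    swap = solve-∀ ℚ-ring

  term-pascal : ∀ n j → term (suc n) (suc j) ≡ x * term (suc n) j + term n (suc j)
  term-pascal n j = begin
    t * x * ι (suc n ℕ.+ j) * inv (suc j)          ≡⟨ cong (λ a → t * x * a * inv (suc j)) ι-split ⟩
    t * x * (ι n + ι (suc j)) * inv (suc j)        ≡⟨ regroup t x (ι n) (ι (suc j)) (inv (suc j)) ⟩
    x * t * (ι (suc j) * inv (suc j)) + t * x * ι n * inv (suc j)
      ≡⟨ cong₂ (λ a b → x * t * a + b) (ι*inv (suc j)) (sym (term-shift n j)) ⟩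
    x * t * 1ℚ + term n (suc j)                    ≡⟨ cong (_+ term n (suc j)) (*-identityʳ (x * t)) ⟩
    x * t + term n (suc j)                         ∎
    where
    open ≡-Reasoning
    t = term (suc n) j
    ι-split : ι (suc n ℕ.+ j) ≡ ι n + ι (suc j)
    ι-split = trans (cong ι (sym (ℕ.+-suc n j))) (ι-+ n (suc j))
    regroup : ∀ t x a b v → t * x * (a + b) * v ≡ x * t * (b * v) + t * x * a * v
    regroup = solve-∀ ℚ-ring

  partialSum-telescope : ∀ n N → (1ℚ - x) * partialSum (suc n) N ≡ partialSum n N - x * term (suc n) N
  partialSum-telescope n zero    = base x
    where
    base : ∀ x → (1ℚ - x) * 1ℚ ≡ 1ℚ - x * 1ℚ
    base = solve-∀ ℚ-ring
  partialSum-telescope n (suc N) = begin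
    (1ℚ - x) * (partialSum (suc n) N + term (suc n) (suc N))
      ≡⟨ *-distribˡ-+ (1ℚ - x) (partialSum (suc n) N) (term (suc n) (suc N)) ⟩
    (1ℚ - x) * partialSum (suc n) N + (1ℚ - x) * term (suc n) (suc N)
      ≡⟨ cong₂ (λ a b → a + (1ℚ - x) * b) (partialSum-telescope n N) (term-pascal n N) ⟩
    partialSum n N - x * a + (1ℚ - x) * (x * a + b)
      ≡⟨ rearrange x (partialSum n N) a b ⟩
    partialSum n N + b - x * (x * a + b)
      ≡⟨ cong (λ t → partialSum n N + b - x * t) (term-pascal n N) ⟨
    partialSum n N + b - x * term (suc n) (suc N) ∎
    where
    open ≡-Reasoning
    a = term (suc n) N
    b = term n (suc N)
    rearrange : ∀ x g a b → g - x * a + (1ℚ - x) * (x * a + b) ≡ g + b - x * (x * a + b)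
    rearrange = solve-∀ ℚ-ring

  term-zero : ∀ j → term 0 (suc j) ≡ 0ℚ
  term-zero zero    = vanish x (inv 1)
    where
    vanish : ∀ x v → 1ℚ * x * ι 0 * v ≡ 0ℚ
    vanish = solve-∀ ℚ-ring
  term-zero (suc j) = trans (cong (λ t → t * x * ι (suc j) * inv (suc (suc j))) (term-zero j))
    (vanish x (ι (suc j)) (inv (suc (suc j))))
    where
    vanish : ∀ x a v → 0ℚ * x * a * v ≡ 0ℚ
    vanish = solve-∀ ℚ-ring

  partialSum-zero : ∀ N → partialSum 0 N ≡ 1ℚ
  partialSum-zero zero    = refl
  partialSum-zero (suc N) = trans (cong₂ _+_ (partialSum-zero N) (term-zero N)) (+-identityʳ 1ℚ)

  module _ (0≤x : 0ℚ ≤ x) where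

    term-nonNeg : ∀ n j → 0ℚ ≤ term n j
    term-nonNeg n zero    = 0≤1
    term-nonNeg n (suc j) =
      *-nonNeg (*-nonNeg (*-nonNeg (term-nonNeg n j) 0≤x) (ι-nonNeg (n ℕ.+ j))) (inv-nonNeg (suc j))

    partialSum-bound : x ≤ 1ℚ → ∀ n N → (1ℚ - x) ^ n * partialSum n N ≤ 1ℚ
    partialSum-bound _   zero    N = ≤-reflexive (trans (*-identityˡ _) (partialSum-zero N))
    partialSum-bound x≤1 (suc n) N = begin
      (1ℚ - x) * (1ℚ - x) ^ n * partialSum (suc n) N
        ≡⟨ reassoc (1ℚ - x) ((1ℚ - x) ^ n) (partialSum (suc n) N) ⟩
      (1ℚ - x) ^ n * ((1ℚ - x) * partialSum (suc n) N)
        ≡⟨ cong ((1ℚ - x) ^ n *_) (partialSum-telescope n N) ⟩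
      (1ℚ - x) ^ n * (partialSum n N - x * term (suc n) N)
        ≤⟨ *-monoˡ-≤ (^-nonNeg n (p≤q⇒0≤q-p x≤1))
             (≤-by-gap (*-nonNeg 0≤x (term-nonNeg (suc n) N)) (sym (minus-plus (partialSum n N) _))) ⟩
      (1ℚ - x) ^ n * partialSum n N
        ≤⟨ partialSum-bound x≤1 n N ⟩
      1ℚ ∎
      where
      open ≤-Reasoning
      reassoc : ∀ a b c → a * b * c ≡ b * (a * c)
      reassoc = solve-∀ ℚ-ring
      minus-plus : ∀ g a → g - a + a ≡ g
      minus-plus = solve-∀ ℚ-ring

    module _ {c : ℚ} {n : ℕ} (0≤c : 0ℚ ≤ c) (c≤xn : c ≤ x * ι n) where

      expTerm-≤-term : ∀ j → expTerm c j ≤ term n j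
      expTerm-≤-term zero    = ≤-refl
      expTerm-≤-term (suc j) = *-monoʳ-≤ (inv-nonNeg (suc j))
        (subst (expTerm c j * c ≤_) (sym (*-assoc (term n j) x (ι (n ℕ.+ j))))
          (*-mono-≤ (term-nonNeg n j) 0≤c (expTerm-≤-term j)
            (≤-trans c≤xn (*-monoˡ-≤ 0≤x (ι-mono-≤ (ℕ.m≤m+n n j))))))

      expPartial-≤-partialSum : ∀ N → expPartial c N ≤ partialSum n N
      expPartial-≤-partialSum zero    = ≤-refl
      expPartial-≤-partialSum (suc N) = +-mono-≤ (expPartial-≤-partialSum N) (expTerm-≤-term (suc N))

expPartial-bound : ∀ {c x} n N → 0ℚ ≤ c → 0ℚ ≤ x → x ≤ 1ℚ → c ≤ x * ι n →
  (1ℚ - x) ^ n * expPartial c N ≤ 1ℚ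
expPartial-bound {c} {x} n N 0≤c 0≤x x≤1 c≤xn = ≤-trans
  (*-monoˡ-≤ (^-nonNeg n (p≤q⇒0≤q-p x≤1)) (expPartial-≤-partialSum 0≤x 0≤c c≤xn N))
  (partialSum-bound 0≤x x≤1 n N)
  where open NegativeBinomial x

∑ : {A : Set} → List A → (A → ℚ) → ℚ
∑ []       f = 0ℚ
∑ (x ∷ xs) f = f x + ∑ xs f

syntax ∑ xs (λ x → e) = ∑[ x ∈ xs ] e

module _ {A : Set} where

  ∑-cong : ∀ (xs : List A) {f g : A → ℚ} → (∀ x → f x ≡ g x) → ∑ xs f ≡ ∑ xs g
  ∑-cong []       _   = refl
  ∑-cong (x ∷ xs) f≗g = cong₂ _+_ (f≗g x) (∑-cong xs f≗g)

  ∑-++ : ∀ (xs ys : List A) f → ∑ (xs ++ ys) f ≡ ∑ xs f + ∑ ys f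
  ∑-++ []       ys f = sym (+-identityˡ (∑ ys f))
  ∑-++ (x ∷ xs) ys f = trans (cong (f x +_) (∑-++ xs ys f)) (sym (+-assoc (f x) (∑ xs f) (∑ ys f)))

  ∑-map : ∀ {B : Set} (g : B → A) (xs : List B) f → ∑ (map g xs) f ≡ ∑ xs (f ∘ g)
  ∑-map g []       f = refl
  ∑-map g (x ∷ xs) f = cong (f (g x) +_) (∑-map g xs f)

  ∑-*ˡ : ∀ (xs : List A) c f → ∑[ x ∈ xs ] (c * f x) ≡ c * ∑ xs f
  ∑-*ˡ []       c f = sym (*-zeroʳ c)
  ∑-*ˡ (x ∷ xs) c f = trans (cong (c * f x +_) (∑-*ˡ xs c f)) (sym (*-distribˡ-+ c (f x) (∑ xs f)))

  ∑-+ : ∀ (xs : List A) f g → ∑[ x ∈ xs ] (f x + g x) ≡ ∑ xs f + ∑ xs g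
  ∑-+ []       f g = sym (+-identityˡ 0ℚ)
  ∑-+ (x ∷ xs) f g = trans (cong (f x + g x +_) (∑-+ xs f g)) (shuffle (f x) (g x) (∑ xs f) (∑ xs g))
    where
    shuffle : ∀ a b c d → a + b + (c + d) ≡ a + c + (b + d)
    shuffle = solve-∀ ℚ-ring

  ι-length : ∀ (xs : List A) → ι (length xs) ≡ ∑[ _ ∈ xs ] 1ℚ
  ι-length []       = refl
  ι-length (x ∷ xs) = trans (ι-suc (length xs)) (cong (1ℚ +_) (ι-length xs))

  markov : ∀ (xs : List A) {P : A → Bool} {f : A → ℚ} → (∀ x → 0ℚ ≤ f x) →
           (∀ x → P x ≡ true → w ≤ f x) → ι (length (filterᵇ P xs)) * w ≤ ∑ xs f
  markov {w} []       _   _ = ≤-reflexive (*-zeroˡ w)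
  markov {w} (x ∷ xs) {P} {f} 0≤f P⇒w≤f with P x in Px
  ... | true  = begin
    ι (suc (length (filterᵇ P xs))) * w      ≡⟨ cong (_* w) (ι-suc (length (filterᵇ P xs))) ⟩
    (1ℚ + ι (length (filterᵇ P xs))) * w     ≡⟨ *-distribʳ-+ w 1ℚ (ι (length (filterᵇ P xs))) ⟩
    1ℚ * w + ι (length (filterᵇ P xs)) * w   ≡⟨ cong (_+ ι (length (filterᵇ P xs)) * w) (*-identityˡ w) ⟩
    w + ι (length (filterᵇ P xs)) * w        ≤⟨ +-mono-≤ (P⇒w≤f x Px) (markov xs 0≤f P⇒w≤f) ⟩
    f x + ∑ xs f                             ∎
    where open ≤-Reasoning
  ... | false = ≤-trans (markov xs 0≤f P⇒w≤f)
    (subst (_≤ f x + ∑ xs f) (+-identityˡ (∑ xs f)) (+-monoˡ-≤ (∑ xs f) (0≤f x)))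

filterᵇ-map : ∀ {A B : Set} (P : B → Bool) (g : A → B) xs →
  filterᵇ P (map g xs) ≡ map g (filterᵇ (P ∘ g) xs)
filterᵇ-map P g []       = refl
filterᵇ-map P g (x ∷ xs) with P (g x)
... | true  = cong (g x ∷_) (filterᵇ-map P g xs)
... | false = filterᵇ-map P g xs

filterᵇ-none : ∀ {A : Set} {P : A → Bool} (xs : List A) → (∀ x → P x ≡ false) → filterᵇ P xs ≡ []
filterᵇ-none []       _   = refl
filterᵇ-none {P = P} (x ∷ xs) ¬P with P x | ¬P x
... | false | _ = filterᵇ-none xs ¬P

samples-zero : ∀ k → samples (suc k) 0 ≡ map (outside ∷_) (samples k 0)
samples-zero k = begin
  filterᵇ P (map (outside ∷_) S ++ map (inside ∷_) S)
    ≡⟨ List.filter-++ (T? ∘ P) (map (outside ∷_) S) (map (inside ∷_) S) ⟩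
  filterᵇ P (map (outside ∷_) S) ++ filterᵇ P (map (inside ∷_) S)
    ≡⟨ cong₂ _++_ (filterᵇ-map P (outside ∷_) S)
         (trans (filterᵇ-map P (inside ∷_) S) (cong (map (inside ∷_)) (filterᵇ-none S (λ _ → refl)))) ⟩
  map (outside ∷_) (samples k 0) ++ []
    ≡⟨ List.++-identityʳ _ ⟩
  map (outside ∷_) (samples k 0) ∎
  where
  open ≡-Reasoning
  S = subsets k
  P = λ (B : Subset (suc k)) → ∣ B ∣ ℕ.≡ᵇ 0

samples-suc : ∀ k s →
  samples (suc k) (suc s) ≡ map (outside ∷_) (samples k (suc s)) ++ map (inside ∷_) (samples k s)
samples-suc k s = begin
  filterᵇ P (map (outside ∷_) S ++ map (inside ∷_) S)
    ≡⟨ List.filter-++ (T? ∘ P) (map (outside ∷_) S) (map (inside ∷_) S) ⟩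
  filterᵇ P (map (outside ∷_) S) ++ filterᵇ P (map (inside ∷_) S)
    ≡⟨ cong₂ _++_ (filterᵇ-map P (outside ∷_) S) (filterᵇ-map P (inside ∷_) S) ⟩
  map (outside ∷_) (samples k (suc s)) ++ map (inside ∷_) (samples k s) ∎
  where
  open ≡-Reasoning
  S = subsets k
  P = λ (B : Subset (suc k)) → ∣ B ∣ ℕ.≡ᵇ suc s

-- Elementary symmetric polynomials and Maclaurin's inequality

esym : ℕ → Vec ℚ n → ℚ
esym zero    ys       = 1ℚ
esym (suc s) []       = 0ℚ
esym (suc s) (y ∷ ys) = esym (suc s) ys + y * esym s ys

prodOn : Vec ℚ n → Subset n → ℚ
prodOn []       []            = 1ℚ
prodOn (y ∷ ys) (inside  ∷ B) = y * prodOn ys B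
prodOn (y ∷ ys) (outside ∷ B) = prodOn ys B

∑-samples-prodOn : ∀ s (ys : Vec ℚ n) → ∑[ B ∈ samples n s ] prodOn ys B ≡ esym s ys
∑-samples-prodOn zero    []       = refl
∑-samples-prodOn (suc s) []       = refl
∑-samples-prodOn {suc n} zero (y ∷ ys) = begin
  ∑[ B ∈ samples (suc n) 0 ] prodOn (y ∷ ys) B
    ≡⟨ cong (λ L → ∑ L (prodOn (y ∷ ys))) (samples-zero n) ⟩
  ∑[ B ∈ map (outside ∷_) (samples n 0) ] prodOn (y ∷ ys) B
    ≡⟨ ∑-map (outside ∷_) (samples n 0) (prodOn (y ∷ ys)) ⟩
  ∑[ B ∈ samples n 0 ] prodOn ys B
    ≡⟨ ∑-samples-prodOn zero ys ⟩
  1ℚ ∎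
  where open ≡-Reasoning
∑-samples-prodOn {suc n} (suc s) (y ∷ ys) = begin
  ∑[ B ∈ samples (suc n) (suc s) ] prodOn (y ∷ ys) B
    ≡⟨ cong (λ L → ∑ L (prodOn (y ∷ ys))) (samples-suc n s) ⟩
  ∑[ B ∈ map (outside ∷_) (samples n (suc s)) ++ map (inside ∷_) (samples n s) ] prodOn (y ∷ ys) B
    ≡⟨ ∑-++ (map (outside ∷_) (samples n (suc s))) (map (inside ∷_) (samples n s)) (prodOn (y ∷ ys)) ⟩
  ∑[ B ∈ map (outside ∷_) (samples n (suc s)) ] prodOn (y ∷ ys) B
    + ∑[ B ∈ map (inside ∷_) (samples n s) ] prodOn (y ∷ ys) B
    ≡⟨ cong₂ _+_ (∑-map (outside ∷_) (samples n (suc s)) (prodOn (y ∷ ys)))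
                 (trans (∑-map (inside ∷_) (samples n s) (prodOn (y ∷ ys))) (∑-*ˡ (samples n s) y (prodOn ys))) ⟩
  ∑[ B ∈ samples n (suc s) ] prodOn ys B + y * ∑[ B ∈ samples n s ] prodOn ys B
    ≡⟨ cong₂ (λ a b → a + y * b) (∑-samples-prodOn (suc s) ys) (∑-samples-prodOn s ys) ⟩
  esym (suc s) ys + y * esym s ys ∎
  where open ≡-Reasoning

binom : ℕ → ℕ → ℚ
binom n s = esym s (replicate n 1ℚ)

prodOn-ones : ∀ (B : Subset n) → prodOn (replicate n 1ℚ) B ≡ 1ℚ
prodOn-ones []            = refl
prodOn-ones (inside  ∷ B) = trans (*-identityˡ _) (prodOn-ones B)
prodOn-ones (outside ∷ B) = prodOn-ones B

ι-length-samples : ∀ n s → ι (length (samples n s)) ≡ binom n s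
ι-length-samples n s = begin
  ι (length (samples n s))                          ≡⟨ ι-length (samples n s) ⟩
  ∑[ _ ∈ samples n s ] 1ℚ                           ≡⟨ ∑-cong (samples n s) (sym ∘ prodOn-ones) ⟩
  ∑[ B ∈ samples n s ] prodOn (replicate n 1ℚ) B    ≡⟨ ∑-samples-prodOn s (replicate n 1ℚ) ⟩
  binom n s                                         ∎
  where open ≡-Reasoning

binom-nonNeg : ∀ n s → 0ℚ ≤ binom n s
binom-nonNeg n       zero    = 0≤1
binom-nonNeg zero    (suc s) = ≤-refl
binom-nonNeg (suc n) (suc s) = +-nonNeg (binom-nonNeg n (suc s)) (*-nonNeg 0≤1 (binom-nonNeg n s))

binom-absorb : ∀ n s → ι (suc s) * binom (suc n) (suc s) ≡ ι (suc n) * binom n s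
binom-absorb zero    zero    = refl
binom-absorb zero    (suc s) = vanish (ι (suc (suc s)))
  where
  vanish : ∀ a → a * (0ℚ + 1ℚ * 0ℚ) ≡ ι 1 * 0ℚ
  vanish = solve-∀ ℚ-ring
binom-absorb (suc n) zero    = begin
  ι 1 * (binom (suc n) 1 + 1ℚ * 1ℚ)   ≡⟨ split (binom (suc n) 1) ⟩
  ι 1 * binom (suc n) 1 + 1ℚ          ≡⟨ cong (_+ 1ℚ) (binom-absorb n zero) ⟩
  ι (suc n) * 1ℚ + 1ℚ                 ≡⟨ cong (λ N → N * 1ℚ + 1ℚ) (ι-suc n) ⟩
  (1ℚ + ι n) * 1ℚ + 1ℚ                ≡⟨ merge (ι n) ⟩
  (1ℚ + (1ℚ + ι n)) * 1ℚ              ≡⟨ cong (_* 1ℚ) (trans (ι-suc (suc n)) (cong (1ℚ +_) (ι-suc n))) ⟨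
  ι (suc (suc n)) * 1ℚ                ∎
  where
  open ≡-Reasoning
  split : ∀ β → ι 1 * (β + 1ℚ * 1ℚ) ≡ ι 1 * β + 1ℚ
  split = solve-∀ ℚ-ring
  merge : ∀ N → (1ℚ + N) * 1ℚ + 1ℚ ≡ (1ℚ + (1ℚ + N)) * 1ℚ
  merge = solve-∀ ℚ-ring
binom-absorb (suc n) (suc s) = begin
  ι (suc (suc s)) * (β₂ + 1ℚ * β₁)
    ≡⟨ cong (λ S → S * (β₂ + 1ℚ * β₁)) (ι-suc (suc s)) ⟩
  (1ℚ + ι (suc s)) * (β₂ + 1ℚ * β₁)
    ≡⟨ split (ι (suc s)) β₁ β₂ ⟩
  (1ℚ + ι (suc s)) * β₂ + ι (suc s) * β₁ + β₁
    ≡⟨ cong (λ S → S * β₂ + ι (suc s) * β₁ + β₁) (ι-suc (suc s)) ⟨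
  ι (suc (suc s)) * β₂ + ι (suc s) * β₁ + β₁
    ≡⟨ cong₂ (λ a b → a + b + β₁) (binom-absorb n (suc s)) (binom-absorb n s) ⟩
  ι (suc n) * binom n (suc s) + ι (suc n) * binom n s + β₁
    ≡⟨ merge (ι (suc n)) (binom n (suc s)) (binom n s) ⟩
  (1ℚ + ι (suc n)) * (binom n (suc s) + 1ℚ * binom n s)
    ≡⟨ cong (_* β₁) (ι-suc (suc n)) ⟨
  ι (suc (suc n)) * β₁ ∎
  where
  open ≡-Reasoning
  β₁ = binom (suc n) (suc s)
  β₂ = binom (suc n) (suc (suc s))
  split : ∀ S β₁ β₂ → (1ℚ + S) * (β₂ + 1ℚ * β₁) ≡ (1ℚ + S) * β₂ + S * β₁ + β₁
  split = solve-∀ ℚ-ring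
  merge : ∀ N a b → N * a + N * b + (a + 1ℚ * b) ≡ (1ℚ + N) * (a + 1ℚ * b)
  merge = solve-∀ ℚ-ring

sumᵛ : Vec ℚ n → ℚ
sumᵛ []       = 0ℚ
sumᵛ (y ∷ ys) = y + sumᵛ ys

sumᵛ-nonNeg : {ys : Vec ℚ n} → All (0ℚ ≤_) ys → 0ℚ ≤ sumᵛ ys
sumᵛ-nonNeg []           = ≤-refl
sumᵛ-nonNeg (0≤y ∷ 0≤ys) = +-nonNeg 0≤y (sumᵛ-nonNeg 0≤ys)

mean : Vec ℚ n → ℚ
mean {zero}  _  = 0ℚ
mean {suc n} ys = sumᵛ ys * inv (suc n)

ι*mean : ∀ (ys : Vec ℚ n) → ι n * mean ys ≡ sumᵛ ys
ι*mean {zero}  [] = refl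
ι*mean {suc n} ys = begin
  ι (suc n) * (sumᵛ ys * inv (suc n))   ≡⟨ swap (ι (suc n)) (sumᵛ ys) (inv (suc n)) ⟩
  sumᵛ ys * (ι (suc n) * inv (suc n))   ≡⟨ cong (sumᵛ ys *_) (ι*inv (suc n)) ⟩
  sumᵛ ys * 1ℚ                          ≡⟨ *-identityʳ (sumᵛ ys) ⟩
  sumᵛ ys                               ∎
  where
  open ≡-Reasoning
  swap : ∀ a b c → a * (b * c) ≡ b * (a * c)
  swap = solve-∀ ℚ-ring

mean-nonNeg : {ys : Vec ℚ n} → All (0ℚ ≤_) ys → 0ℚ ≤ mean ys
mean-nonNeg {zero}  _     = ≤-refl
mean-nonNeg {suc n} 0≤ys = *-nonNeg (sumᵛ-nonNeg 0≤ys) (inv-nonNeg (suc n))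

-- Peeling off y and bounding the rest by its own mean u′, the two inductive bounds combine
-- (via binom-absorb) into β′ u′ ^ s (u′ + (s + 1) (u - u′)), which Bernoulli bounds by β′ u ^ (s + 1).
maclaurin-step : ∀ {y u u′} {zs : Vec ℚ n} → 0ℚ ≤ y → 0ℚ ≤ u′ → y + ι n * u′ ≤ ι (suc n) * u →
  (∀ s → esym s zs ≤ binom n s * u′ ^ s) → ∀ s → esym s (y ∷ zs) ≤ binom (suc n) s * u ^ s
maclaurin-step _ _ _ _ zero = ≤-refl
maclaurin-step {n} {y} {u} {u′} {zs} 0≤y 0≤u′ y≤ ih (suc s) = *-cancelˡ-≤ (ι-pos (suc n)) (begin
  N * (esym (suc s) zs + y * esym s zs)
    ≤⟨ *-monoˡ-≤ (ι-nonNeg (suc n)) (+-mono-≤ (ih (suc s)) (*-monoˡ-≤ 0≤y (ih s))) ⟩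
  N * (β₁ * (u′ * P) + y * (β * P))
    ≡⟨ regroup N S β β₁ P u′ y ⟩
  (β₁ + 1ℚ * β) * P * ((N - S) * u′ + S * y) + (N * β - S * (β₁ + 1ℚ * β)) * P * (y - u′)
    ≡⟨ cong (λ t → β′ * P * ((N - S) * u′ + S * y) + t * P * (y - u′)) absorbed ⟩
  β′ * P * ((N - S) * u′ + S * y) + 0ℚ * P * (y - u′)
    ≡⟨ drop (β′ * P * ((N - S) * u′ + S * y)) P (y - u′) ⟩
  β′ * P * ((N - S) * u′ + S * y)
    ≤⟨ *-monoˡ-≤ (*-nonNeg (binom-nonNeg (suc n) (suc s)) (^-nonNeg s 0≤u′))
         (+-monoʳ-≤ ((N - S) * u′) (*-monoˡ-≤ (ι-nonNeg (suc s)) y≤′)) ⟩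
  β′ * P * ((N - S) * u′ + S * (N * u - ι n * u′))
    ≡⟨ cong (λ t → β′ * P * ((t - S) * u′ + S * (t * u - ι n * u′))) (ι-suc n) ⟩
  β′ * P * (((1ℚ + ι n) - S) * u′ + S * ((1ℚ + ι n) * u - ι n * u′))
    ≡⟨ factor β′ P S (ι n) u u′ ⟩
  (1ℚ + ι n) * (β′ * (P * (u′ + S * (u - u′))))
    ≡⟨ cong (λ t → t * (β′ * (P * (u′ + S * (u - u′))))) (ι-suc n) ⟨
  N * (β′ * (u′ ^ s * (u′ + S * (u - u′))))
    ≤⟨ *-monoˡ-≤ (ι-nonNeg (suc n)) (*-monoˡ-≤ (binom-nonNeg (suc n) (suc s))
         (bernoulli-homogeneous s 0≤u′ (subst (0ℚ ≤_) (sym (u′+[u-u′] u′ u)) 0≤u))) ⟩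
  N * (β′ * (u′ + (u - u′)) ^ suc s)
    ≡⟨ cong (λ t → N * (β′ * t ^ suc s)) (u′+[u-u′] u′ u) ⟩
  N * (β′ * u ^ suc s) ∎)
  where
  open ≤-Reasoning
  N = ι (suc n)
  S = ι (suc s)
  P = u′ ^ s
  β = binom n s
  β₁ = binom n (suc s)
  β′ = binom (suc n) (suc s)
  absorbed : N * β - S * β′ ≡ 0ℚ
  absorbed = trans (cong (λ t → N * β - t) (binom-absorb n s)) (+-inverseʳ (N * β))
  y≤′ : y ≤ N * u - ι n * u′
  y≤′ = subst (_≤ N * u - ι n * u′) (plus-minus y (ι n * u′)) (+-monoˡ-≤ (- (ι n * u′)) y≤)
    where
    plus-minus : ∀ a b → a + b - b ≡ a
    plus-minus = solve-∀ ℚ-ring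
  0≤u : 0ℚ ≤ u
  0≤u = *-cancelˡ-≤ (ι-pos (suc n)) (subst (_≤ N * u) (sym (*-zeroʳ N))
          (≤-trans (+-nonNeg 0≤y (*-nonNeg (ι-nonNeg n) 0≤u′)) y≤))
  u′+[u-u′] : ∀ a b → a + (b - a) ≡ b
  u′+[u-u′] = solve-∀ ℚ-ring
  regroup : ∀ N S β β₁ P u′ y → N * (β₁ * (u′ * P) + y * (β * P))
          ≡ (β₁ + 1ℚ * β) * P * ((N - S) * u′ + S * y) + (N * β - S * (β₁ + 1ℚ * β)) * P * (y - u′)
  regroup = solve-∀ ℚ-ring
  drop : ∀ a P b → a + 0ℚ * P * b ≡ a
  drop = solve-∀ ℚ-ring
  factor : ∀ β′ P S n u u′ → β′ * P * (((1ℚ + n) - S) * u′ + S * ((1ℚ + n) * u - n * u′))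
         ≡ (1ℚ + n) * (β′ * (P * (u′ + S * (u - u′))))
  factor = solve-∀ ℚ-ring

maclaurin : ∀ (ys : Vec ℚ n) {u} → All (0ℚ ≤_) ys → sumᵛ ys ≤ ι n * u → ∀ s → esym s ys ≤ binom n s * u ^ s
maclaurin []       _            _     zero    = ≤-refl
maclaurin []       {u} _        _     (suc s) = ≤-reflexive (sym (*-zeroˡ (u ^ suc s)))
maclaurin {suc n} (y ∷ zs) {u} (0≤y ∷ 0≤zs) sum≤nu = maclaurin-step 0≤y (mean-nonNeg 0≤zs)
  (subst (λ t → y + t ≤ ι (suc n) * u) (sym (ι*mean zs)) sum≤nu)
  (maclaurin zs 0≤zs (≤-reflexive (sym (ι*mean zs))))

-- Exponential moments of sample sums

prodOn-map-^ : ∀ θ K (bs : Vec ℕ n) (B : Subset n) →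
  prodOn (Vec.map (λ b → θ ^ (K ℕ.* b)) bs) B ≡ θ ^ (K ℕ.* σOn bs B)
prodOn-map-^ θ K []       []            = cong (θ ^_) (sym (ℕ.*-zeroʳ K))
prodOn-map-^ θ K (b ∷ bs) (outside ∷ B) = prodOn-map-^ θ K bs B
prodOn-map-^ θ K (b ∷ bs) (inside  ∷ B) = begin
  θ ^ (K ℕ.* b) * prodOn (Vec.map (λ b → θ ^ (K ℕ.* b)) bs) B  ≡⟨ cong (θ ^ (K ℕ.* b) *_) (prodOn-map-^ θ K bs B) ⟩
  θ ^ (K ℕ.* b) * θ ^ (K ℕ.* σOn bs B)                           ≡⟨ ^-homo-* θ (K ℕ.* b) (K ℕ.* σOn bs B) ⟨
  θ ^ (K ℕ.* b ℕ.+ K ℕ.* σOn bs B)                              ≡⟨ cong (θ ^_) (ℕ.*-distribˡ-+ K b (σOn bs B)) ⟨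
  θ ^ (K ℕ.* (b ℕ.+ σOn bs B))                                  ∎
  where open ≡-Reasoning

moment-bound : ∀ {θ Z} K (bs : Vec ℕ n) s → 0ℚ ≤ θ →
  sumᵛ (Vec.map (λ b → θ ^ (K ℕ.* b)) bs) ≤ ι n * Z →
  ∑[ B ∈ samples n s ] (θ ^ (K ℕ.* σOn bs B)) ≤ binom n s * Z ^ s
moment-bound {n} {θ} {Z} K bs s 0≤θ mean≤Z = begin
  ∑[ B ∈ samples n s ] (θ ^ (K ℕ.* σOn bs B))  ≡⟨ ∑-cong (samples n s) (sym ∘ prodOn-map-^ θ K bs) ⟩
  ∑[ B ∈ samples n s ] prodOn ys B             ≡⟨ ∑-samples-prodOn s ys ⟩
  esym s ys                                    ≤⟨ maclaurin ys (powers-nonNeg bs) mean≤Z s ⟩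
  binom n s * Z ^ s                            ∎
  where
  open ≤-Reasoning
  ys = Vec.map (λ b → θ ^ (K ℕ.* b)) bs
  powers-nonNeg : ∀ {n} (bs : Vec ℕ n) → All (0ℚ ≤_) (Vec.map (λ b → θ ^ (K ℕ.* b)) bs)
  powers-nonNeg []       = []
  powers-nonNeg (b ∷ bs) = ^-nonNeg (K ℕ.* b) 0≤θ ∷ powers-nonNeg bs

sumᵛ-map-affine : ∀ {M} (f : ℕ → ℚ) w {bs : Vec ℕ n} → (∀ {b} → b ℕ.≤ M → f b ≤ 1ℚ + w * ι b) →
  All (ℕ._≤ M) bs → sumᵛ (Vec.map f bs) ≤ ι n + w * ι (Vec.sum bs)
sumᵛ-map-affine f w {[]} _ [] = ≤-reflexive (base w)
  where
  base : ∀ w → 0ℚ ≡ ι 0 + w * ι 0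
  base = solve-∀ ℚ-ring
sumᵛ-map-affine {n = suc n} f w {b ∷ bs} f≤ (b≤M ∷ bs≤M) = begin
  f b + sumᵛ (Vec.map f bs)                         ≤⟨ +-mono-≤ (f≤ b≤M) (sumᵛ-map-affine f w f≤ bs≤M) ⟩
  1ℚ + w * ι b + (ι n + w * ι (Vec.sum bs))         ≡⟨ regroup (ι n) w (ι b) (ι (Vec.sum bs)) ⟩
  (1ℚ + ι n) + w * (ι b + ι (Vec.sum bs))           ≡⟨ cong₂ (λ a c → a + w * c) (ι-suc n) (ι-+ b (Vec.sum bs)) ⟨
  ι (suc n) + w * ι (b ℕ.+ Vec.sum bs)              ∎
  where
  open ≤-Reasoning
  regroup : ∀ n w b t → 1ℚ + w * b + (n + w * t) ≡ (1ℚ + n) + w * (b + t)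
  regroup = solve-∀ ℚ-ring

restrict : Vec ℕ n → Subset n → Vec ℕ n
restrict []       []       = []
restrict (a ∷ as) (t ∷ ts) = (if t then a else 0) ∷ restrict as ts

σOn-∩ : ∀ (A : Vec ℕ n) As B → σOn A (B ∩ As) ≡ σOn (restrict A As) B
σOn-∩ []       []       []            = refl
σOn-∩ (a ∷ A) (t ∷ As) (inside  ∷ B) = cong ((if t then a else 0) ℕ.+_) (σOn-∩ A As B)
σOn-∩ (a ∷ A) (t ∷ As) (outside ∷ B) = σOn-∩ A As B

σOn≡sum-restrict : ∀ (A : Vec ℕ n) As → σOn A As ≡ Vec.sum (restrict A As)
σOn≡sum-restrict []       []       = refl
σOn≡sum-restrict (a ∷ A) (t ∷ As) = cong ((if t then a else 0) ℕ.+_) (σOn≡sum-restrict A As)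

σOn-≤-sum : ∀ (bs : Vec ℕ n) B → σOn bs B ℕ.≤ Vec.sum bs
σOn-≤-sum []       []            = ℕ.z≤n
σOn-≤-sum (b ∷ bs) (inside  ∷ B) = ℕ.+-monoʳ-≤ b (σOn-≤-sum bs B)
σOn-≤-sum (b ∷ bs) (outside ∷ B) = ℕ.≤-trans (σOn-≤-sum bs B) (ℕ.m≤n+m (Vec.sum bs) b)

restrict-≤-maxOn : ∀ (A : Vec ℕ n) As → All (ℕ._≤ maxOn A As) (restrict A As)
restrict-≤-maxOn []       []       = []
restrict-≤-maxOn (a ∷ A) (t ∷ As) = ℕ.m≤m⊔n _ (maxOn A As) ∷
  All.map (λ b≤ → ℕ.≤-trans b≤ (ℕ.m≤n⊔m _ (maxOn A As))) (restrict-≤-maxOn A As)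

σOn-≤-∣∣*maxOn : ∀ (A : Vec ℕ n) As → σOn A As ℕ.≤ ∣ As ∣ ℕ.* maxOn A As
σOn-≤-∣∣*maxOn []       []             = ℕ.z≤n
σOn-≤-∣∣*maxOn (a ∷ A) (inside  ∷ As) = ℕ.+-mono-≤ (ℕ.m≤m⊔n a (maxOn A As))
  (ℕ.≤-trans (σOn-≤-∣∣*maxOn A As) (ℕ.*-monoʳ-≤ ∣ As ∣ (ℕ.m≤n⊔m a (maxOn A As))))
σOn-≤-∣∣*maxOn (a ∷ A) (outside ∷ As) = σOn-≤-∣∣*maxOn A As

module Sampling (k s : ℕ) .{{_ : NonZero k}} (s≤k : s ℕ.≤ k) (A : Vec ℕ k) (As : Subset k)
                (c : ℚ) (1≤c : 1ℚ ≤ c) where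

  bs : Vec ℕ k
  bs = restrict A As

  σ* m* M* : ℕ
  σ* = σOn A As
  m* = ∣ As ∣
  M* = maxOn A As

  σ∩ : Subset k → ℕ
  σ∩ B = σOn A (B ∩ As)

  D : Subset k → ℚ
  D B = ι (σ∩ B) - (ℤ.+ s / k) * ι σ*

  R² : ℚ
  R² = ι 16 * c * c * ι m* * ι M* * ι M*

  0≤c : 0ℚ ≤ c
  0≤c = ≤-trans 0≤1 1≤c

  bad⇒deviation : ∀ B → bad k s A As c B ≡ true → R² < D B * D B
  bad⇒deviation B bad≡true =
    invert (subst (Reflects (R² < D B * D B)) bad≡true (proof (R² <? D B * D B)))

  s/k-nonNeg : 0ℚ ≤ ℤ.+ s / k
  s/k-nonNeg = nonNegative⁻¹ _ {{normalize-nonNeg s k}}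

  s/k≤1 : ℤ.+ s / k ≤ 1ℚ
  s/k≤1 = *-cancelʳ-≤ (ι-pos k)
    (subst₂ _≤_ (sym (/-*-cancel s k)) (sym (*-identityˡ (ι k))) (ι-mono-≤ s≤k))

  σ∩≤σ* : ∀ B → σ∩ B ℕ.≤ σ*
  σ∩≤σ* B = subst₂ ℕ._≤_ (sym (σOn-∩ A As B)) (sym (σOn≡sum-restrict A As)) (σOn-≤-sum bs B)

  σ*≤k*M* : σ* ℕ.≤ k ℕ.* M*
  σ*≤k*M* = ℕ.≤-trans (σOn-≤-∣∣*maxOn A As) (ℕ.*-monoˡ-≤ M* (∣p∣≤n As))

  D²≤σ*² : ∀ B → D B * D B ≤ ι σ* * ι σ*
  D²≤σ*² B = ≤-by-gap
    (*-nonNeg (+-nonNeg (p≤q⇒0≤q-p (ι-mono-≤ (σ∩≤σ* B))) (*-nonNeg s/k-nonNeg (ι-nonNeg σ*)))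
              (+-nonNeg (ι-nonNeg (σ∩ B)) (*-nonNeg (p≤q⇒0≤q-p s/k≤1) (ι-nonNeg σ*))))
    (difference-of-squares (ι (σ∩ B)) (ℤ.+ s / k) (ι σ*))
    where
    difference-of-squares : ∀ a p t →
      t * t ≡ (a - p * t) * (a - p * t) + (t - a + p * t) * (a + (1ℚ - p) * t)
    difference-of-squares = solve-∀ ℚ-ring

  [m*M*]²≤R² : m* ℕ.≤ 16 ⊎ M* ≡ 0 → (ι m* * ι M*) * (ι m* * ι M*) ≤ R²
  [m*M*]²≤R² (inj₁ m*≤16) = begin
    (ι m* * ι M*) * (ι m* * ι M*)          ≡⟨ regroup (ι m*) (ι M*) ⟩
    ι m* * (ι m* * ι M* * ι M*)            ≤⟨ *-monoʳ-≤ m*M*²-nonNeg m*≤16cc ⟩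
    ι 16 * c * c * (ι m* * ι M* * ι M*)    ≡⟨ reassoc (ι 16 * c * c) (ι m*) (ι M*) ⟩
    R²                                     ∎
    where
    open ≤-Reasoning
    m*M*²-nonNeg : 0ℚ ≤ ι m* * ι M* * ι M*
    m*M*²-nonNeg = *-nonNeg (*-nonNeg (ι-nonNeg m*) (ι-nonNeg M*)) (ι-nonNeg M*)
    m*≤16cc : ι m* ≤ ι 16 * c * c
    m*≤16cc = ≤-trans (ι-mono-≤ m*≤16)
      (*-mono-≤ (*-nonNeg (ι-nonNeg 16) 0≤c) 0≤1 (*-monoˡ-≤ (ι-nonNeg 16) 1≤c) 1≤c)
    regroup : ∀ m M → (m * M) * (m * M) ≡ m * (m * M * M)
    regroup = solve-∀ ℚ-ring
    reassoc : ∀ x m M → x * (m * M * M) ≡ x * m * M * M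
    reassoc = solve-∀ ℚ-ring
  [m*M*]²≤R² (inj₂ M*≡0) = ≤-reflexive (begin
    (ι m* * ι M*) * (ι m* * ι M*)          ≡⟨ cong (λ t → (ι m* * ι t) * (ι m* * ι t)) M*≡0 ⟩
    (ι m* * ι 0) * (ι m* * ι 0)            ≡⟨ vanish (ι m*) c ⟩
    ι 16 * c * c * ι m* * ι 0 * ι 0        ≡⟨ cong (λ t → ι 16 * c * c * ι m* * ι t * ι t) M*≡0 ⟨
    R²                                     ∎)
    where
    open ≡-Reasoning
    vanish : ∀ m c → (m * ι 0) * (m * ι 0) ≡ ι 16 * c * c * m * ι 0 * ι 0
    vanish = solve-∀ ℚ-ring

  no-bad : (ι m* * ι M*) * (ι m* * ι M*) ≤ R² → ∀ B → bad k s A As c B ≡ false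
  no-bad [m*M*]²≤R² B = ¬-not λ bad≡true →
    <-irrefl refl (<-≤-trans (bad⇒deviation B bad≡true) (≤-trans (D²≤σ*² B) σ*²≤R²))
    where
    σ*≤m*M* : ι σ* ≤ ι m* * ι M*
    σ*≤m*M* = subst (ι σ* ≤_) (ι-* m* M*) (ι-mono-≤ (σOn-≤-∣∣*maxOn A As))
    σ*²≤R² : ι σ* * ι σ* ≤ R²
    σ*²≤R² = ≤-trans
      (*-mono-≤ (*-nonNeg (ι-nonNeg m*) (ι-nonNeg M*)) (ι-nonNeg σ*) σ*≤m*M* σ*≤m*M*) [m*M*]²≤R²

  badCount≡0 : m* ℕ.≤ 16 ⊎ M* ≡ 0 → badCount k s A As c ≡ 0
  badCount≡0 small = cong length (filterᵇ-none (samples k s) (no-bad ([m*M*]²≤R² small)))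

  k*D : ∀ B → ι k * D B ≡ ι (k ℕ.* σ∩ B) - ι (σ* ℕ.* s)
  k*D B = begin
    ι k * (ι (σ∩ B) - (ℤ.+ s / k) * ι σ*)
      ≡⟨ distrib (ι k) (ι (σ∩ B)) (ℤ.+ s / k) (ι σ*) ⟩
    ι k * ι (σ∩ B) - (ℤ.+ s / k) * ι k * ι σ*
      ≡⟨ cong₂ (λ a b → a - b * ι σ*) (sym (ι-* k (σ∩ B))) (/-*-cancel s k) ⟩
    ι (k ℕ.* σ∩ B) - ι s * ι σ*
      ≡⟨ cong (λ t → ι (k ℕ.* σ∩ B) - t) (trans (*-comm (ι s) (ι σ*)) (sym (ι-* σ* s))) ⟩
    ι (k ℕ.* σ∩ B) - ι (σ* ℕ.* s) ∎
    where
    open ≡-Reasoning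
    distrib : ∀ k a p t → k * (a - p * t) ≡ k * a - p * k * t
    distrib = solve-∀ ℚ-ring

  bad⇒far : ∀ X → ι X * ι X ≤ ι k * ι k * R² → ∀ B → bad k s A As c B ≡ true →
            σ* ℕ.* s ℕ.+ X ℕ.< k ℕ.* σ∩ B ⊎ k ℕ.* σ∩ B ℕ.+ X ℕ.< σ* ℕ.* s
  bad⇒far X X²≤k²R² B bad≡true = square-<⇒apart X (k ℕ.* σ∩ B) (σ* ℕ.* s) (begin-strict
    ι X * ι X                  ≤⟨ X²≤k²R² ⟩
    ι k * ι k * R²             <⟨ *-monoʳ-<-pos (ι k * ι k) {{positive (*-pos (ι-pos k) (ι-pos k))}}
                                    (bad⇒deviation B bad≡true) ⟩
    ι k * ι k * (D B * D B)    ≡⟨ regroup (ι k) (D B) ⟩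
    ι k * D B * (ι k * D B)    ≡⟨ cong (λ t → t * t) (k*D B) ⟩
    (ι (k ℕ.* σ∩ B) - ι (σ* ℕ.* s)) * (ι (k ℕ.* σ∩ B) - ι (σ* ℕ.* s)) ∎)
    where
    open ≤-Reasoning
    regroup : ∀ k d → k * k * (d * d) ≡ k * d * (k * d)
    regroup = solve-∀ ℚ-ring

  centred-moment-bound : ∀ {θ θ′ ε} → θ′ * θ ≡ 1ℚ → 0ℚ ≤ θ → 0ℚ ≤ θ′ →
    sumᵛ (Vec.map (λ b → θ ^ (k ℕ.* b)) bs) ≤ ι k * (θ ^ σ* * (1ℚ + ε)) →
    ∑[ B ∈ samples k s ] (θ′ ^ (σ* ℕ.* s) * θ ^ (k ℕ.* σ∩ B)) ≤ binom k s * (1ℚ + ε) ^ s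
  centred-moment-bound {θ} {θ′} {ε} θ′θ≡1 0≤θ 0≤θ′ mean≤ = begin
    ∑[ B ∈ samples k s ] (θ′ ^ σ*s * θ ^ (k ℕ.* σ∩ B))
      ≡⟨ ∑-*ˡ (samples k s) (θ′ ^ σ*s) (λ B → θ ^ (k ℕ.* σ∩ B)) ⟩
    θ′ ^ σ*s * ∑[ B ∈ samples k s ] (θ ^ (k ℕ.* σ∩ B))
      ≡⟨ cong (θ′ ^ σ*s *_) (∑-cong (samples k s) (λ B → cong (λ t → θ ^ (k ℕ.* t)) (σOn-∩ A As B))) ⟩
    θ′ ^ σ*s * ∑[ B ∈ samples k s ] (θ ^ (k ℕ.* σOn bs B))
      ≤⟨ *-monoˡ-≤ (^-nonNeg σ*s 0≤θ′) (moment-bound k bs s 0≤θ mean≤) ⟩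
    θ′ ^ σ*s * (C * (θ ^ σ* * (1ℚ + ε)) ^ s)
      ≡⟨ cong (λ t → θ′ ^ σ*s * (C * t)) (^-distrib-* (θ ^ σ*) (1ℚ + ε) s) ⟩
    θ′ ^ σ*s * (C * ((θ ^ σ*) ^ s * (1ℚ + ε) ^ s))
      ≡⟨ cong (λ t → θ′ ^ σ*s * (C * (t * (1ℚ + ε) ^ s))) (^-assocʳ θ σ* s) ⟩
    θ′ ^ σ*s * (C * (θ ^ σ*s * (1ℚ + ε) ^ s))
      ≡⟨ regroup (θ′ ^ σ*s) (θ ^ σ*s) C ((1ℚ + ε) ^ s) ⟩
    θ′ ^ σ*s * θ ^ σ*s * (C * (1ℚ + ε) ^ s)
      ≡⟨ cong (_* (C * (1ℚ + ε) ^ s)) (^-distrib-* θ′ θ σ*s) ⟨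
    (θ′ * θ) ^ σ*s * (C * (1ℚ + ε) ^ s)
      ≡⟨ cong (λ t → t ^ σ*s * (C * (1ℚ + ε) ^ s)) θ′θ≡1 ⟩
    1ℚ ^ σ*s * (C * (1ℚ + ε) ^ s)
      ≡⟨ trans (cong (_* (C * (1ℚ + ε) ^ s)) (1^n≡1 σ*s)) (*-identityˡ (C * (1ℚ + ε) ^ s)) ⟩
    C * (1ℚ + ε) ^ s ∎
    where
    open ≤-Reasoning
    σ*s = σ* ℕ.* s
    C = binom k s
    regroup : ∀ a b c e → a * (c * (b * e)) ≡ a * b * (c * e)
    regroup = solve-∀ ℚ-ring

  module Chernoff (Q : ℕ) (Q²≤m* : Q ℕ.* Q ℕ.≤ m*) (2m*≤3Q² : 2 ℕ.* m* ℕ.≤ 3 ℕ.* (Q ℕ.* Q))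
                  (4≤Q : 4 ℕ.≤ Q) (1≤M* : 1 ℕ.≤ M*) where

    u Qu : ℕ
    u  = k ℕ.* M*
    Qu = Q ℕ.* u

    1≤u : 1 ℕ.≤ u
    1≤u = ℕ.*-mono-≤ (ℕ.>-nonZero⁻¹ k) 1≤M*

    instance
      Q-nonZero : NonZero Q
      Q-nonZero = ℕ.>-nonZero (ℕ.≤-trans (ℕ.s≤s ℕ.z≤n) 4≤Q)
      Qu-nonZero : NonZero Qu
      Qu-nonZero = ℕ.>-nonZero (ℕ.*-mono-≤ (ℕ.>-nonZero⁻¹ Q) 1≤u)

    δ d r⁺ r⁻ ε : ℚ
    δ  = inv Qu
    d  = inv (suc Qu)
    r⁺ = 1ℚ + δ
    r⁻ = 1ℚ - d
    ε  = ⅔ * δ * δ * ι k * ι M* * ι σ*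

    0≤δ : 0ℚ ≤ δ
    0≤δ = inv-nonNeg Qu

    0≤d : 0ℚ ≤ d
    0≤d = inv-nonNeg (suc Qu)

    d≤δ : d ≤ δ
    d≤δ = *-cancelˡ-≤ (ι-pos Qu) (begin
      ι Qu * d          ≤⟨ *-monoʳ-≤ 0≤d (ι-mono-≤ (ℕ.n≤1+n Qu)) ⟩
      ι (suc Qu) * d    ≡⟨ ι*inv (suc Qu) ⟩
      1ℚ                ≡⟨ ι*inv Qu ⟨
      ι Qu * δ          ∎)
      where open ≤-Reasoning

    d≤1 : d ≤ 1ℚ
    d≤1 = begin
      d                 ≡⟨ *-identityˡ d ⟨
      1ℚ * d            ≤⟨ *-monoʳ-≤ 0≤d (ι-mono-≤ (ℕ.s≤s (ℕ.z≤n {Qu}))) ⟩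
      ι (suc Qu) * d    ≡⟨ ι*inv (suc Qu) ⟩
      1ℚ                ∎
      where open ≤-Reasoning

    1≤r⁺ : 1ℚ ≤ r⁺
    1≤r⁺ = ≤-by-gap 0≤δ refl

    0≤r⁺ : 0ℚ ≤ r⁺
    0≤r⁺ = ≤-trans 0≤1 1≤r⁺

    0≤r⁻ : 0ℚ ≤ r⁻
    0≤r⁻ = p≤q⇒0≤q-p d≤1

    r⁻r⁺≡1 : r⁻ * r⁺ ≡ 1ℚ
    r⁻r⁺≡1 = begin
      (1ℚ - d) * (1ℚ + δ)
        ≡⟨ expand d δ (ι Qu) ⟩
      1ℚ + δ * (1ℚ - (1ℚ + ι Qu) * d) + d * (ι Qu * δ - 1ℚ)
        ≡⟨ cong₂ (λ a b → 1ℚ + δ * (1ℚ - a) + d * (b - 1ℚ))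
             (trans (cong (_* d) (sym (ι-suc Qu))) (ι*inv (suc Qu))) (ι*inv Qu) ⟩
      1ℚ + δ * (1ℚ - 1ℚ) + d * (1ℚ - 1ℚ)
        ≡⟨ collapse δ d ⟩
      1ℚ ∎
      where
      open ≡-Reasoning
      expand : ∀ d δ q → (1ℚ - d) * (1ℚ + δ) ≡ 1ℚ + δ * (1ℚ - (1ℚ + q) * d) + d * (q * δ - 1ℚ)
      expand = solve-∀ ℚ-ring
      collapse : ∀ δ d → 1ℚ + δ * (1ℚ - 1ℚ) + d * (1ℚ - 1ℚ) ≡ 1ℚ
      collapse = solve-∀ ℚ-ring

    kM*δ≤¼ : ι k * ι M* * δ ≤ ¼
    kM*δ≤¼ = *-cancelʳ-≤ (ι-pos Q) (begin
      ι k * ι M* * δ * ι Q      ≡⟨ regroup (ι k) (ι M*) δ (ι Q) ⟩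
      ι Q * (ι k * ι M*) * δ    ≡⟨ cong (_* δ) (trans (ι-* Q u) (cong (ι Q *_) (ι-* k M*))) ⟨
      ι Qu * δ                  ≡⟨ ι*inv Qu ⟩
      ¼ * ι 4                   ≤⟨ *-monoˡ-≤ (nonNegative⁻¹ ¼) (ι-mono-≤ 4≤Q) ⟩
      ¼ * ι Q                   ∎)
      where
      open ≤-Reasoning
      regroup : ∀ k M δ Q → k * M * δ * Q ≡ Q * (k * M) * δ
      regroup = solve-∀ ℚ-ring

    σ*d≤¼ : ι σ* * d ≤ ¼
    σ*d≤¼ = ≤-trans (*-mono-≤ (ι-nonNeg u) 0≤d (ι-mono-≤ σ*≤k*M*) d≤δ)
                    (subst (λ t → t * δ ≤ ¼) (sym (ι-* k M*)) kM*δ≤¼)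

    0≤ε : 0ℚ ≤ ε
    0≤ε = *-nonNeg (*-nonNeg (*-nonNeg (*-nonNeg (*-nonNeg (nonNegative⁻¹ ⅔) 0≤δ) 0≤δ)
      (ι-nonNeg k)) (ι-nonNeg M*)) (ι-nonNeg σ*)

    ι-sum-bs : ι (Vec.sum bs) ≡ ι σ*
    ι-sum-bs = cong ι (sym (σOn≡sum-restrict A As))

    mean⁺ : sumᵛ (Vec.map (λ b → r⁺ ^ (k ℕ.* b)) bs) ≤ ι k * (r⁺ ^ σ* * (1ℚ + ε))
    mean⁺ = begin
      sumᵛ (Vec.map (λ b → r⁺ ^ (k ℕ.* b)) bs)
        ≤⟨ sumᵛ-map-affine _ w⁺ (taylor⁺-affine {K = k} 0≤δ kM*δ≤½) (restrict-≤-maxOn A As) ⟩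
      ι k + w⁺ * ι (Vec.sum bs)
        ≡⟨ cong (λ t → ι k + w⁺ * t) ι-sum-bs ⟩
      ι k + (ι k * δ + ⅔ * (ι k * δ) * (ι k * δ) * ι M*) * ι σ*
        ≡⟨ factor (ι k) δ (ι M*) (ι σ*) ⟩
      ι k * (1ℚ + ι σ* * δ + ε)
        ≤⟨ *-monoˡ-≤ (ι-nonNeg k) (≤-by-gap (*-nonNeg (*-nonNeg (ι-nonNeg σ*) 0≤δ) 0≤ε)
                                             (expand (ι σ* * δ) ε)) ⟩
      ι k * ((1ℚ + ι σ* * δ) * (1ℚ + ε))
        ≤⟨ *-monoˡ-≤ (ι-nonNeg k) (*-monoʳ-≤ (+-nonNeg 0≤1 0≤ε) (bernoulli σ* (+-nonNeg 0≤1 0≤δ))) ⟩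
      ι k * (r⁺ ^ σ* * (1ℚ + ε)) ∎
      where
      open ≤-Reasoning
      w⁺ = ι k * δ + ⅔ * (ι k * δ) * (ι k * δ) * ι M*
      kM*δ≤½ : ι k * ι M* * δ ≤ ½
      kM*δ≤½ = ≤-trans kM*δ≤¼ (*≤* (ℤ.+≤+ (ℕ.s≤s (ℕ.s≤s ℕ.z≤n))))
      factor : ∀ k δ M σ →
        k + (k * δ + ⅔ * (k * δ) * (k * δ) * M) * σ ≡ k * (1ℚ + σ * δ + ⅔ * δ * δ * k * M * σ)
      factor = solve-∀ ℚ-ring
      expand : ∀ a e → (1ℚ + a) * (1ℚ + e) ≡ 1ℚ + a + e + a * e
      expand = solve-∀ ℚ-ring

    mean⁻ : sumᵛ (Vec.map (λ b → r⁻ ^ (k ℕ.* b)) bs) ≤ ι k * (r⁻ ^ σ* * (1ℚ + ε))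
    mean⁻ = begin
      sumᵛ (Vec.map (λ b → r⁻ ^ (k ℕ.* b)) bs)
        ≤⟨ sumᵛ-map-affine _ w⁻ (taylor⁻-affine {K = k} 0≤d d≤1) (restrict-≤-maxOn A As) ⟩
      ι k + w⁻ * ι (Vec.sum bs)
        ≡⟨ cong (λ t → ι k + w⁻ * t) ι-sum-bs ⟩
      ι k + (- (ι k * d) + ½ * - (ι k * d) * - (ι k * d) * ι M*) * ι σ*
        ≡⟨ factor (ι k) d (ι M*) (ι σ*) ⟩
      ι k * (1ℚ - ι σ* * d + ½ * (d * d) * (ι k * ι M* * ι σ*))
        ≤⟨ *-monoˡ-≤ (ι-nonNeg k) (+-monoʳ-≤ (1ℚ - ι σ* * d)
             (*-monoʳ-≤ kM*σ*-nonNeg (*-monoˡ-≤ (nonNegative⁻¹ ½) (*-mono-≤ 0≤δ 0≤d d≤δ d≤δ)))) ⟩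
      ι k * (1ℚ - ι σ* * d + ½ * (δ * δ) * (ι k * ι M* * ι σ*))
        ≡⟨ cong (λ t → ι k * (1ℚ - ι σ* * d + t)) (three-quarters δ (ι k) (ι M*) (ι σ*)) ⟩
      ι k * (1ℚ - ι σ* * d + ¾ * ε)
        ≤⟨ *-monoˡ-≤ (ι-nonNeg k) (+-monoʳ-≤ (1ℚ - ι σ* * d) (*-monoʳ-≤ 0≤ε ¾≤1-σ*d)) ⟩
      ι k * (1ℚ - ι σ* * d + (1ℚ - ι σ* * d) * ε)
        ≡⟨ cong (ι k *_) (collect (ι σ*) d ε) ⟩
      ι k * ((1ℚ + ι σ* * - d) * (1ℚ + ε))
        ≤⟨ *-monoˡ-≤ (ι-nonNeg k) (*-monoʳ-≤ (+-nonNeg 0≤1 0≤ε) (bernoulli σ* 0≤r⁻)) ⟩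
      ι k * (r⁻ ^ σ* * (1ℚ + ε)) ∎
      where
      open ≤-Reasoning
      w⁻ = - (ι k * d) + ½ * - (ι k * d) * - (ι k * d) * ι M*
      kM*σ*-nonNeg : 0ℚ ≤ ι k * ι M* * ι σ*
      kM*σ*-nonNeg = *-nonNeg (*-nonNeg (ι-nonNeg k) (ι-nonNeg M*)) (ι-nonNeg σ*)
      ¾≤1-σ*d : ¾ ≤ 1ℚ - ι σ* * d
      ¾≤1-σ*d = +-monoʳ-≤ 1ℚ (neg-antimono-≤ σ*d≤¼)
      factor : ∀ k d M σ → k + (- (k * d) + ½ * - (k * d) * - (k * d) * M) * σ
                          ≡ k * (1ℚ - σ * d + ½ * (d * d) * (k * M * σ))
      factor = solve-∀ ℚ-ring
      three-quarters : ∀ δ k M σ → ½ * (δ * δ) * (k * M * σ) ≡ ¾ * (⅔ * δ * δ * k * M * σ)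
      three-quarters = solve-∀ ℚ-ring
      collect : ∀ σ d e → 1ℚ - σ * d + (1ℚ - σ * d) * e ≡ (1ℚ + σ * - d) * (1ℚ + e)
      collect = solve-∀ ℚ-ring

    2kM*σ*≤3QM*Qu : 2 ℕ.* (k ℕ.* M* ℕ.* σ*) ℕ.≤ 3 ℕ.* (Q ℕ.* M*) ℕ.* Qu
    2kM*σ*≤3QM*Qu = begin
      2 ℕ.* (k ℕ.* M* ℕ.* σ*)                ≤⟨ ℕ.*-monoʳ-≤ 2 (ℕ.*-monoʳ-≤ u (σOn-≤-∣∣*maxOn A As)) ⟩
      2 ℕ.* (k ℕ.* M* ℕ.* (m* ℕ.* M*))       ≡⟨ shuffle₁ k M* m* ⟩
      2 ℕ.* m* ℕ.* (k ℕ.* M* ℕ.* M*)         ≤⟨ ℕ.*-monoˡ-≤ (k ℕ.* M* ℕ.* M*) 2m*≤3Q² ⟩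
      3 ℕ.* (Q ℕ.* Q) ℕ.* (k ℕ.* M* ℕ.* M*)  ≡⟨ shuffle₂ k M* Q ⟩
      3 ℕ.* (Q ℕ.* M*) ℕ.* Qu                ∎
      where
      open ℕ.≤-Reasoning
      shuffle₁ : ∀ k M m → 2 ℕ.* (k ℕ.* M ℕ.* (m ℕ.* M)) ≡ 2 ℕ.* m ℕ.* (k ℕ.* M ℕ.* M)
      shuffle₁ = ℕ-Solver.solve-∀
      shuffle₂ : ∀ k M Q → 3 ℕ.* (Q ℕ.* Q) ℕ.* (k ℕ.* M ℕ.* M) ≡ 3 ℕ.* (Q ℕ.* M) ℕ.* (Q ℕ.* (k ℕ.* M))
      shuffle₂ = ℕ-Solver.solve-∀

    ε≤QM*δ : ε ≤ ι (Q ℕ.* M*) * δ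
    ε≤QM*δ = *-cancelʳ-≤ 0<3Qu² (begin
      ε * (ι 3 * ι Qu * ι Qu)
        ≡⟨ expand-ε δ (ι k) (ι M*) (ι σ*) (ι Qu) ⟩
      ι 2 * (ι k * ι M* * ι σ*) * ((ι Qu * δ) * (ι Qu * δ))
        ≡⟨ cong (λ t → ι 2 * (ι k * ι M* * ι σ*) * (t * t)) (ι*inv Qu) ⟩
      ι 2 * (ι k * ι M* * ι σ*) * (1ℚ * 1ℚ)
        ≡⟨ *-identityʳ (ι 2 * (ι k * ι M* * ι σ*)) ⟩
      ι 2 * (ι k * ι M* * ι σ*)
        ≡⟨ ι-2kM*σ* ⟨
      ι (2 ℕ.* (k ℕ.* M* ℕ.* σ*))
        ≤⟨ ι-mono-≤ 2kM*σ*≤3QM*Qu ⟩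
      ι (3 ℕ.* (Q ℕ.* M*) ℕ.* Qu)
        ≡⟨ ι-3QM*Qu ⟩
      ι 3 * ι (Q ℕ.* M*) * ι Qu * 1ℚ
        ≡⟨ cong (ι 3 * ι (Q ℕ.* M*) * ι Qu *_) (ι*inv Qu) ⟨
      ι 3 * ι (Q ℕ.* M*) * ι Qu * (ι Qu * δ)
        ≡⟨ regroup (ι 3) (ι (Q ℕ.* M*)) (ι Qu) δ ⟩
      ι (Q ℕ.* M*) * δ * (ι 3 * ι Qu * ι Qu) ∎)
      where
      open ≤-Reasoning
      0<3Qu² : 0ℚ < ι 3 * ι Qu * ι Qu
      0<3Qu² = *-pos (*-pos (ι-pos 3) (ι-pos Qu)) (ι-pos Qu)
      expand-ε : ∀ δ k M σ q → ⅔ * δ * δ * k * M * σ * (ι 3 * q * q) ≡ ι 2 * (k * M * σ) * ((q * δ) * (q * δ))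
      expand-ε = solve-∀ ℚ-ring
      regroup : ∀ a b q δ → a * b * q * (q * δ) ≡ b * δ * (a * q * q)
      regroup = solve-∀ ℚ-ring
      ι-2kM*σ* : ι (2 ℕ.* (k ℕ.* M* ℕ.* σ*)) ≡ ι 2 * (ι k * ι M* * ι σ*)
      ι-2kM*σ* = trans (ι-* 2 (k ℕ.* M* ℕ.* σ*))
        (cong (ι 2 *_) (trans (ι-* (k ℕ.* M*) σ*) (cong (_* ι σ*) (ι-* k M*))))
      ι-3QM*Qu : ι (3 ℕ.* (Q ℕ.* M*) ℕ.* Qu) ≡ ι 3 * ι (Q ℕ.* M*) * ι Qu * 1ℚ
      ι-3QM*Qu = trans (ι-* (3 ℕ.* (Q ℕ.* M*)) Qu)
        (trans (cong (_* ι Qu) (ι-* 3 (Q ℕ.* M*))) (sym (*-identityʳ _)))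

    [1+ε]^s≤r⁺^Qu : (1ℚ + ε) ^ s ≤ r⁺ ^ Qu
    [1+ε]^s≤r⁺^Qu = begin
      (1ℚ + ε) ^ s               ≤⟨ ^-monoˡ-≤ s (+-nonNeg 0≤1 0≤ε) 1+ε≤r⁺^QM* ⟩
      (r⁺ ^ (Q ℕ.* M*)) ^ s      ≡⟨ ^-assocʳ r⁺ (Q ℕ.* M*) s ⟩
      r⁺ ^ (Q ℕ.* M* ℕ.* s)      ≤⟨ ^-monoʳ-≤ 1≤r⁺ (ℕ.*-monoʳ-≤ (Q ℕ.* M*) s≤k) ⟩
      r⁺ ^ (Q ℕ.* M* ℕ.* k)      ≡⟨ cong (r⁺ ^_) (shuffle Q M* k) ⟩
      r⁺ ^ Qu                    ∎
      where
      open ≤-Reasoning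
      1+ε≤r⁺^QM* : 1ℚ + ε ≤ r⁺ ^ (Q ℕ.* M*)
      1+ε≤r⁺^QM* = ≤-trans (+-monoʳ-≤ 1ℚ ε≤QM*δ) (bernoulli (Q ℕ.* M*) (+-nonNeg 0≤1 0≤δ))
      shuffle : ∀ Q M k → Q ℕ.* M ℕ.* k ≡ Q ℕ.* (k ℕ.* M)
      shuffle = ℕ-Solver.solve-∀

    2≤r⁺^Qu : 1ℚ + 1ℚ ≤ r⁺ ^ Qu
    2≤r⁺^Qu = subst (λ t → 1ℚ + t ≤ r⁺ ^ Qu) (ι*inv Qu) (bernoulli Qu (+-nonNeg 0≤1 0≤δ))

    expPartial≤r⁺^ : ∀ ν N → c ≤ d * ι ν → expPartial c N ≤ r⁺ ^ ν
    expPartial≤r⁺^ ν N c≤dν = begin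
      expPartial c N
        ≡⟨ *-identityˡ (expPartial c N) ⟨
      1ℚ * expPartial c N
        ≡⟨ cong (_* expPartial c N) (trans (sym (1^n≡1 ν)) (cong (_^ ν) (sym r⁻r⁺≡1))) ⟩
      (r⁻ * r⁺) ^ ν * expPartial c N
        ≡⟨ cong (_* expPartial c N) (trans (^-distrib-* r⁻ r⁺ ν) (*-comm (r⁻ ^ ν) (r⁺ ^ ν))) ⟩
      r⁺ ^ ν * r⁻ ^ ν * expPartial c N
        ≡⟨ *-assoc (r⁺ ^ ν) (r⁻ ^ ν) (expPartial c N) ⟩
      r⁺ ^ ν * (r⁻ ^ ν * expPartial c N)
        ≤⟨ *-monoˡ-≤ (^-nonNeg ν 0≤r⁺) (expPartial-bound ν N 0≤c 0≤d d≤1 c≤dν) ⟩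
      r⁺ ^ ν * 1ℚ
        ≡⟨ *-identityʳ (r⁺ ^ ν) ⟩
      r⁺ ^ ν ∎
      where open ≤-Reasoning

    module _ (b : ℕ) (c[Q+1]≤b : c * ι (suc Q) ≤ ι b) (b<c[Q+1]+1 : ι b < c * ι (suc Q) + 1ℚ) where

      ν X : ℕ
      ν = b ℕ.* u
      X = ν ℕ.+ (Qu ℕ.+ Qu)

      c≤dν : c ≤ d * ι ν
      c≤dν = begin
        c                            ≡⟨ *-identityʳ c ⟨
        c * 1ℚ                       ≡⟨ cong (c *_) (ι*inv (suc Qu)) ⟨
        c * (ι (suc Qu) * d)         ≡⟨ *-assoc c (ι (suc Qu)) d ⟨
        c * ι (suc Qu) * d           ≤⟨ *-monoʳ-≤ 0≤d (*-monoˡ-≤ 0≤c (ι-mono-≤ (ℕ.+-monoˡ-≤ Qu 1≤u))) ⟩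
        c * ι (suc Q ℕ.* u) * d      ≡⟨ cong (λ t → c * t * d) (ι-* (suc Q) u) ⟩
        c * (ι (suc Q) * ι u) * d    ≡⟨ cong (_* d) (*-assoc c (ι (suc Q)) (ι u)) ⟨
        c * ι (suc Q) * ι u * d      ≤⟨ *-monoʳ-≤ 0≤d (*-monoʳ-≤ (ι-nonNeg u) c[Q+1]≤b) ⟩
        ι b * ι u * d                ≡⟨ trans (*-comm d (ι ν)) (cong (_* d) (ι-* b u)) ⟨
        d * ι ν                      ∎
        where open ≤-Reasoning

      b+2Q≤4cQ : ι b + (ι Q + ι Q) ≤ ι 4 * c * ι Q
      b+2Q≤4cQ = begin
        ι b + (ι Q + ι Q)                    ≤⟨ +-monoˡ-≤ (ι Q + ι Q) (<⇒≤ b<c[Q+1]+1) ⟩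
        c * ι (suc Q) + 1ℚ + (ι Q + ι Q)     ≡⟨ cong (λ t → c * t + 1ℚ + (ι Q + ι Q)) (ι-suc Q) ⟩
        c * (1ℚ + ι Q) + 1ℚ + (ι Q + ι Q)    ≤⟨ ≤-by-gap gap-nonNeg (expand c (ι Q)) ⟩
        ι 4 * c * ι Q                        ∎
        where
        open ≤-Reasoning
        0≤Q-2 : 0ℚ ≤ ι Q - ι 2
        0≤Q-2 = p≤q⇒0≤q-p (ι-mono-≤ (ℕ.≤-trans (ℕ.s≤s (ℕ.s≤s ℕ.z≤n)) 4≤Q))
        gap-nonNeg : 0ℚ ≤ (c - 1ℚ) * (ι 3 * (ι Q - ι 2) + ι 5) + (ι Q - ι 2)
        gap-nonNeg = +-nonNeg
          (*-nonNeg (p≤q⇒0≤q-p 1≤c) (+-nonNeg (*-nonNeg (ι-nonNeg 3) 0≤Q-2) (ι-nonNeg 5))) 0≤Q-2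
        expand : ∀ c Q → ι 4 * c * Q
               ≡ c * (1ℚ + Q) + 1ℚ + (Q + Q) + ((c - 1ℚ) * (ι 3 * (Q - ι 2) + ι 5) + (Q - ι 2))
        expand = solve-∀ ℚ-ring

      X²≤k²R² : ι X * ι X ≤ ι k * ι k * R²
      X²≤k²R² = begin
        ι X * ι X
          ≡⟨ cong (λ t → t * t) ιX≡ ⟩
        (ι b + (ι Q + ι Q)) * ι u * ((ι b + (ι Q + ι Q)) * ι u)
          ≤⟨ *-mono-≤ 0≤4cQu 0≤[b+2Q]u [b+2Q]u≤4cQu [b+2Q]u≤4cQu ⟩
        ι 4 * c * ι Q * ι u * (ι 4 * c * ι Q * ι u)
          ≡⟨ square c (ι Q) (ι u) ⟩
        ι 16 * c * c * (ι Q * ι Q) * (ι u * ι u)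
          ≤⟨ *-monoʳ-≤ (square-nonNeg (ι u)) (*-monoˡ-≤ 0≤16cc Q²≤m*′) ⟩
        ι 16 * c * c * ι m* * (ι u * ι u)
          ≡⟨ cong (λ t → ι 16 * c * c * ι m* * (t * t)) (ι-* k M*) ⟩
        ι 16 * c * c * ι m* * (ι k * ι M* * (ι k * ι M*))
          ≡⟨ regroup (ι 16 * c * c * ι m*) (ι k) (ι M*) ⟩
        ι k * ι k * R² ∎
        where
        open ≤-Reasoning
        ιX≡ : ι X ≡ (ι b + (ι Q + ι Q)) * ι u
        ιX≡ = begin-equality
          ι (ν ℕ.+ (Qu ℕ.+ Qu))                  ≡⟨ trans (ι-+ ν (Qu ℕ.+ Qu)) (cong (ι ν +_) (ι-+ Qu Qu)) ⟩
          ι ν + (ι Qu + ι Qu)                    ≡⟨ cong₂ (λ x y → x + (y + y)) (ι-* b u) (ι-* Q u) ⟩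
          ι b * ι u + (ι Q * ι u + ι Q * ι u)    ≡⟨ collect (ι b) (ι Q) (ι u) ⟩
          (ι b + (ι Q + ι Q)) * ι u              ∎
          where
          collect : ∀ b Q u → b * u + (Q * u + Q * u) ≡ (b + (Q + Q)) * u
          collect = solve-∀ ℚ-ring
        0≤[b+2Q]u : 0ℚ ≤ (ι b + (ι Q + ι Q)) * ι u
        0≤[b+2Q]u = *-nonNeg (+-nonNeg (ι-nonNeg b) (+-nonNeg (ι-nonNeg Q) (ι-nonNeg Q))) (ι-nonNeg u)
        [b+2Q]u≤4cQu : (ι b + (ι Q + ι Q)) * ι u ≤ ι 4 * c * ι Q * ι u
        [b+2Q]u≤4cQu = *-monoʳ-≤ (ι-nonNeg u) b+2Q≤4cQ
        0≤4cQu : 0ℚ ≤ ι 4 * c * ι Q * ι u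
        0≤4cQu = ≤-trans 0≤[b+2Q]u [b+2Q]u≤4cQu
        0≤16cc : 0ℚ ≤ ι 16 * c * c
        0≤16cc = *-nonNeg (*-nonNeg (ι-nonNeg 16) 0≤c) 0≤c
        Q²≤m*′ : ι Q * ι Q ≤ ι m*
        Q²≤m*′ = subst (_≤ ι m*) (ι-* Q Q) (ι-mono-≤ Q²≤m*)
        square : ∀ c Q u → ι 4 * c * Q * u * (ι 4 * c * Q * u) ≡ ι 16 * c * c * (Q * Q) * (u * u)
        square = solve-∀ ℚ-ring
        regroup : ∀ x k M → x * (k * M * (k * M)) ≡ k * k * (x * M * M)
        regroup = solve-∀ ℚ-ring

      -- r⁺ ^ ± (k σ∩ B - σ* s), with natural exponents since r⁻ = 1 / r⁺.
      weight⁺ weight⁻ : Subset k → ℚ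
      weight⁺ B = r⁻ ^ (σ* ℕ.* s) * r⁺ ^ (k ℕ.* σ∩ B)
      weight⁻ B = r⁺ ^ (σ* ℕ.* s) * r⁻ ^ (k ℕ.* σ∩ B)

      weight-nonNeg : ∀ B → 0ℚ ≤ weight⁺ B + weight⁻ B
      weight-nonNeg B = +-nonNeg (*-nonNeg (^-nonNeg (σ* ℕ.* s) 0≤r⁻) (^-nonNeg (k ℕ.* σ∩ B) 0≤r⁺))
                                 (*-nonNeg (^-nonNeg (σ* ℕ.* s) 0≤r⁺) (^-nonNeg (k ℕ.* σ∩ B) 0≤r⁻))

      bad⇒r⁺^X≤weight : ∀ B → bad k s A As c B ≡ true → r⁺ ^ X ≤ weight⁺ B + weight⁻ B
      bad⇒r⁺^X≤weight B bad≡true = [ above , below ]′ (bad⇒far X X²≤k²R² B bad≡true)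
        where
        above : σ* ℕ.* s ℕ.+ X ℕ.< k ℕ.* σ∩ B → r⁺ ^ X ≤ weight⁺ B + weight⁻ B
        above far = ≤-trans (^-≤-quotient {a = σ* ℕ.* s} {b = k ℕ.* σ∩ B} r⁻r⁺≡1 1≤r⁺ 0≤r⁻ (ℕ.<⇒≤ far))
          (≤-by-gap {weight⁻ B} {weight⁺ B + weight⁻ B} {weight⁺ B}
            (*-nonNeg (^-nonNeg (σ* ℕ.* s) 0≤r⁺) (^-nonNeg (k ℕ.* σ∩ B) 0≤r⁻)) refl)
        below : k ℕ.* σ∩ B ℕ.+ X ℕ.< σ* ℕ.* s → r⁺ ^ X ≤ weight⁺ B + weight⁻ B
        below far = ≤-trans (^-≤-quotient {a = k ℕ.* σ∩ B} {b = σ* ℕ.* s} r⁻r⁺≡1 1≤r⁺ 0≤r⁻ (ℕ.<⇒≤ far))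
          (≤-by-gap {weight⁺ B} {weight⁺ B + weight⁻ B} {r⁻ ^ (k ℕ.* σ∩ B) * r⁺ ^ (σ* ℕ.* s)}
            (*-nonNeg (^-nonNeg (σ* ℕ.* s) 0≤r⁻) (^-nonNeg (k ℕ.* σ∩ B) 0≤r⁺))
            (trans (+-comm (weight⁺ B) (weight⁻ B))
                   (cong (_+ weight⁺ B) (*-comm (r⁺ ^ (σ* ℕ.* s)) (r⁻ ^ (k ℕ.* σ∩ B))))))

      badCount*r⁺^X≤ : ι (badCount k s A As c) * r⁺ ^ X ≤ binom k s * (1ℚ + ε) ^ s + binom k s * (1ℚ + ε) ^ s
      badCount*r⁺^X≤ = begin
        ι (badCount k s A As c) * r⁺ ^ X
          ≤⟨ markov (samples k s) {bad k s A As c} {λ B → weight⁺ B + weight⁻ B} weight-nonNeg bad⇒r⁺^X≤weight ⟩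
        ∑[ B ∈ samples k s ] (weight⁺ B + weight⁻ B)
          ≡⟨ ∑-+ (samples k s) weight⁺ weight⁻ ⟩
        ∑ (samples k s) weight⁺ + ∑ (samples k s) weight⁻
          ≤⟨ +-mono-≤ (centred-moment-bound {r⁺} {r⁻} {ε} r⁻r⁺≡1 0≤r⁺ 0≤r⁻ mean⁺)
                      (centred-moment-bound {r⁻} {r⁺} {ε} (trans (*-comm r⁺ r⁻) r⁻r⁺≡1) 0≤r⁻ 0≤r⁺ mean⁻) ⟩
        binom k s * (1ℚ + ε) ^ s + binom k s * (1ℚ + ε) ^ s ∎
        where open ≤-Reasoning

      tail-bound : ∀ N → ι (badCount k s A As c) * expPartial c N ≤ ι (length (samples k s))
      tail-bound N = *-cancelʳ-≤ (*-pos (^-pos Qu 0<r⁺) (^-pos Qu 0<r⁺)) (begin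
        ι #bad * expPartial c N * (r⁺ ^ Qu * r⁺ ^ Qu)
          ≤⟨ *-monoʳ-≤ (*-nonNeg (^-nonNeg Qu 0≤r⁺) (^-nonNeg Qu 0≤r⁺))
               (*-monoˡ-≤ (ι-nonNeg #bad) (expPartial≤r⁺^ ν N c≤dν)) ⟩
        ι #bad * r⁺ ^ ν * (r⁺ ^ Qu * r⁺ ^ Qu)
          ≡⟨ *-assoc (ι #bad) (r⁺ ^ ν) (r⁺ ^ Qu * r⁺ ^ Qu) ⟩
        ι #bad * (r⁺ ^ ν * (r⁺ ^ Qu * r⁺ ^ Qu))
          ≡⟨ cong (ι #bad *_) r⁺^X-split ⟨
        ι #bad * r⁺ ^ X
          ≤⟨ badCount*r⁺^X≤ ⟩
        C * (1ℚ + ε) ^ s + C * (1ℚ + ε) ^ s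
          ≤⟨ +-mono-≤ (*-monoˡ-≤ 0≤C [1+ε]^s≤r⁺^Qu) (*-monoˡ-≤ 0≤C [1+ε]^s≤r⁺^Qu) ⟩
        C * r⁺ ^ Qu + C * r⁺ ^ Qu
          ≡⟨ double C (r⁺ ^ Qu) ⟩
        (1ℚ + 1ℚ) * (C * r⁺ ^ Qu)
          ≤⟨ *-monoʳ-≤ (*-nonNeg 0≤C (^-nonNeg Qu 0≤r⁺)) 2≤r⁺^Qu ⟩
        r⁺ ^ Qu * (C * r⁺ ^ Qu)
          ≡⟨ regroup (r⁺ ^ Qu) C ⟩
        C * (r⁺ ^ Qu * r⁺ ^ Qu)
          ≡⟨ cong (_* (r⁺ ^ Qu * r⁺ ^ Qu)) (ι-length-samples k s) ⟨
        ι (length (samples k s)) * (r⁺ ^ Qu * r⁺ ^ Qu) ∎)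
        where
        open ≤-Reasoning
        #bad : ℕ
        #bad = badCount k s A As c
        C : ℚ
        C = binom k s
        0≤C : 0ℚ ≤ C
        0≤C = binom-nonNeg k s
        0<r⁺ : 0ℚ < r⁺
        0<r⁺ = <-≤-trans 0<1 1≤r⁺
        r⁺^X-split : r⁺ ^ X ≡ r⁺ ^ ν * (r⁺ ^ Qu * r⁺ ^ Qu)
        r⁺^X-split = trans (^-homo-* r⁺ ν (Qu ℕ.+ Qu)) (cong (r⁺ ^ ν *_) (^-homo-* r⁺ Qu Qu))
        double : ∀ a b → a * b + a * b ≡ (1ℚ + 1ℚ) * (a * b)
        double = solve-∀ ℚ-ring
        regroup : ∀ a c → a * (c * a) ≡ c * (a * a)
        regroup = solve-∀ ℚ-ring

  chernoff-bound : 16 ℕ.< m* → 1 ℕ.≤ M* → ∀ N →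
    ι (badCount k s A As c) * expPartial c N ≤ ι (length (samples k s))
  chernoff-bound 16<m* 1≤M* N = with-root (isqrt m*)
    where
    goal = ι (badCount k s A As c) * expPartial c N ≤ ι (length (samples k s))
    with-root : Σ ℕ (λ Q → Q ℕ.* Q ℕ.≤ m* × m* ℕ.< suc Q ℕ.* suc Q) → goal
    with-root (Q , Q²≤m* , m*<[Q+1]²) =
      with-ceiling (nat-ceiling (c * ι (suc Q)) (*-nonNeg 0≤c (ι-nonNeg (suc Q))))
      where
      4≤Q = 16<[1+Q]²⇒4≤Q (ℕ.<-trans 16<m* m*<[Q+1]²)
      with-ceiling : Σ ℕ (λ b → c * ι (suc Q) ≤ ι b × ι b < c * ι (suc Q) + 1ℚ) → goal
      with-ceiling (b , c[Q+1]≤b , b<c[Q+1]+1) =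
        Chernoff.tail-bound Q Q²≤m* (2m≤3Q² 4≤Q m*<[Q+1]²) 4≤Q 1≤M* b c[Q+1]≤b b<c[Q+1]+1 N

lemma28 : (k s : ℕ) .{{_ : NonZero k}} → s Data.Nat.≤ k →
    (A : Vec ℕ k) (Astar : Subset k) (c : ℚ) → 1ℚ ≤ c → (N : ℕ) →
    ℕtoℚ (badCount k s A Astar c) * expPartial c N ≤ ℕtoℚ (length (samples k s))
lemma28 k s s≤k A Astar c 1≤c N = by-cases (16 ℕ.<? m*) (M* ℕ.≟ 0)
  where
  open Sampling k s s≤k A Astar c 1≤c
  goal = ι (badCount k s A Astar c) * expPartial c N ≤ ι (length (samples k s))
  no-bad⇒bound : badCount k s A Astar c ≡ 0 → goal
  no-bad⇒bound none = subst (λ t → ι t * expPartial c N ≤ ι (length (samples k s))) (sym none)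
    (≤-trans (≤-reflexive (*-zeroˡ (expPartial c N))) (ι-nonNeg (length (samples k s))))
  by-cases : Dec (16 ℕ.< m*) → Dec (M* ≡ 0) → goal
  by-cases (no 16≮m*)  _          = no-bad⇒bound (badCount≡0 (inj₁ (ℕ.≮⇒≥ 16≮m*)))
  by-cases (yes _)     (yes M*≡0) = no-bad⇒bound (badCount≡0 (inj₂ M*≡0))
  by-cases (yes 16<m*) (no M*≢0)  = chernoff-bound 16<m* (ℕ.n≢0⇒n>0 M*≢0) N
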